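{- For every $\epsilon > 0$ there exists $\Delta_0 = \Delta_0(\epsilon)$ such that the following holds. For every $\Delta \ge \Delta_0$ there exists $N_0 = N_0(\Delta)$ such that if $G = (U \cup V, E)$ is a bipartite graph with bipartition $(U,V)$, $|U| = |V| = n \ge N_0$, and average degree $\Delta$, then $G$ contains a bi-hole of size $(1-\epsilon)\frac{\log \Delta}{\Delta} n$.
   Context: A bipartite graph $G=(U\cup V,E)$ has a prescribed vertex bipartition $(U,V)$; it is balanced if $|U|=|V|$. A balanced bipartite independent set (bi-hole) of size $t$ in $G$ is a pair $(X,Y)$ with $X \subseteq U$, $Y \subseteq V$, $|X| = |Y| = t$, such that no edge of $G$ has one endpoint in $X$ and the other in $Y$. The average degree is taken over all $2n$ vertices, i.e. $|E| = \Delta n$. $\log$ denotes the natural logarithm. Non-integer sizes are to be understood with floors/ceilings omitted (as in the paper).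
   Formalization: The parameter ε ranges over the positive rationals, and the threshold Δ₀ is taken in the rationals. -}

module Defs where

open import Data.Nat using (ℕ; zero; suc)
open import Data.Integer using (+_)
open import Data.Rational using (ℚ; 0ℚ; 1ℚ; _+_; _*_; _<_; _≤_; _/_; 1/_; positive)
open import Data.Rational.Properties using (_<?_; pos⇒nonZero)
open import Data.Fin using (Fin)
open import Data.Fin.Subset using (Subset; _∈_; _∉_; ∣_∣)
open import Data.Vec using (sum; tabulate)
open import Data.Product using (Σ; _×_; ∃)
open import Data.Sum using (_⊎_)
open import Relation.Nullary using (yes; no)
open import Relation.Binary.PropositionalEquality using (_≡_)

ℕ→ℚ : ℕ → ℚ
ℕ→ℚ n = (+ n) / 1

-- A bipartite graph with parts U = Fin n and V = Fin n (balanced,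
-- prescribed bipartition).  adj u is the neighbourhood of u ∈ U in V.
BipGraph : ℕ → Set
BipGraph n = Fin n → Subset n

edgeCount : ∀ {n} → BipGraph n → ℕ
edgeCount {n} G = sum (tabulate (λ u → ∣ G u ∣))

IsBiHole : ∀ {n} → BipGraph n → ℕ → Subset n → Subset n → Set
IsBiHole G t X Y =
  (∣ X ∣ ≡ t) × (∣ Y ∣ ≡ t) × (∀ u v → u ∈ X → v ∈ Y → v ∉ G u)

HasBiHole : ∀ {n} → BipGraph n → ℕ → Set
HasBiHole {n} G t = Σ (Subset n) λ X → Σ (Subset n) λ Y → IsBiHole G t X Y

-- Exponential via its Taylor series: expTerm x k = x^k / k!,
-- expSum x K = Σ_{k ≤ K} x^k / k!.
expTerm : ℚ → ℕ → ℚ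
expTerm x zero = 1ℚ
expTerm x (suc k) = expTerm x k * x * ((+ 1) / suc k)

expSum : ℚ → ℕ → ℚ
expSum x zero = 1ℚ
expSum x (suc K) = expSum x K + expTerm x (suc K)

-- "a < exp y"  (faithful for y ≥ 0, where the partial sums increase to exp y)
LtExp : ℚ → ℚ → Set
LtExp a y = ∃ λ K → a < expSum y K

-- "c · log D < d", intended for D ≥ 1 and d > 0 (the only case used):
--   c ≤ 0 : then c · log D ≤ 0 < d holds as soon as D ≥ 1;
--   c > 0 : c · log D < d  iff  D < exp (d / c).
MulLogLt : (c D d : ℚ) → Set
MulLogLt c D d with 0ℚ <? c
... | no _ = 1ℚ ≤ D
... | yes c>0 = LtExp D (d * (1/ c) {{pos⇒nonZero c {{positive c>0}}}})

{-# OPTIONS --safe #-}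
-- Fix b ≥ 1/ε, q = 4(b+1) and p = q + 2, let Δ = E/n and D = ⌊(q+1)Δ/q⌋. By Markov, more
-- than n/(q+1) vertices of V have degree at most D; call their number y₀. Greedily move into X
-- a vertex of U with fewest neighbours in the current set Y of such vertices and delete those
-- neighbours from Y: by double counting the j-th step keeps a fraction (n-j-D)/(n-j) of Y.
-- This yields a bi-hole of size s with, for m = s + 1, y₀/m < (1 + D/A)^m where A = n - s - D.
-- That forces Δ < (1 + Z/X)^m for X = b n², Z = (b+1) Δ n. Otherwise, cutting m into blocks of
-- length p shows m < p n Δ^(1/p - 1), so m is small, (1 + D/A)^p ≤ (1 + Z/X)^q and
-- (y₀/m)^p < Δ^q; as p = q + 2 the two bounds on m are incompatible once Δ ≥ (16 (b+1) p)^p.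
-- Finally (b+1)/b ≤ 1/(1-ε) and (1 + z)^m ≤ Σ_{k≤m} (m z)^k/k!, which turns Δ < (1 + Z/X)^m
-- into (1-ε) n log Δ < m Δ.

module Submission where

module PowerInequalities where

  open import Data.Nat
  open import Data.Nat.Properties
  open import Data.Nat.DivMod using (_/_; _%_; m≡m%n+[m/n]*n; m%n<n)
  open import Relation.Binary.PropositionalEquality
  open import Data.Nat.Tactic.RingSolver

  ^-distribʳ-* : ∀ x y k → (x * y) ^ k ≡ x ^ k * y ^ k
  ^-distribʳ-* x y zero = refl
  ^-distribʳ-* x y (suc k) = begin
    x * y * (x * y) ^ k     ≡⟨ cong (x * y *_) (^-distribʳ-* x y k) ⟩
    x * y * (x ^ k * y ^ k) ≡⟨ regroup x y (x ^ k) (y ^ k) ⟩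
    x * x ^ k * (y * y ^ k) ∎
    where
    open ≡-Reasoning
    regroup : ∀ x y u v → x * y * (u * v) ≡ x * u * (y * v)
    regroup = solve-∀

  ^-comm : ∀ x i j → (x ^ i) ^ j ≡ (x ^ j) ^ i
  ^-comm x i j = begin
    (x ^ i) ^ j ≡⟨ ^-*-assoc x i j ⟩
    x ^ (i * j) ≡⟨ cong (x ^_) (*-comm i j) ⟩
    x ^ (j * i) ≡⟨ ^-*-assoc x j i ⟨
    (x ^ j) ^ i ∎
    where open ≡-Reasoning

  -- Bernoulli's inequality (1 + z)^M ≥ 1 + M z, with z = Z / X cleared of denominators.
  bernoulli : ∀ X Z M → X ^ M * (X + M * Z) ≤ (X + Z) ^ M * X
  bernoulli X Z zero = ≤-reflexive (+-identityʳ (X + 0))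
  bernoulli X Z (suc M) = begin
    X * X ^ M * (X + suc M * Z)                        ≤⟨ m≤m+n _ (X ^ M * (M * Z * Z)) ⟩
    X * X ^ M * (X + suc M * Z) + X ^ M * (M * Z * Z)  ≡⟨ expand X Z M (X ^ M) ⟩
    (X + Z) * (X ^ M * (X + M * Z))                    ≤⟨ *-monoʳ-≤ (X + Z) (bernoulli X Z M) ⟩
    (X + Z) * ((X + Z) ^ M * X)                        ≡⟨ *-assoc (X + Z) _ X ⟨
    (X + Z) * (X + Z) ^ M * X                          ∎
    where
    open ≤-Reasoning
    expand : ∀ X Z M XM → X * XM * (X + suc M * Z) + XM * (M * Z * Z) ≡ (X + Z) * (XM * (X + M * Z))
    expand = solve-∀

  -- (1 + d)^p (1 - p d) ≤ 1, with d = D / A cleared of denominators.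
  reverse-bernoulli : ∀ A D p → (A + D) ^ p * (A ∸ p * D) ≤ A ^ p * A
  reverse-bernoulli A D zero = ≤-refl
  reverse-bernoulli A D (suc p) = begin
    (A + D) * (A + D) ^ p * (A ∸ (D + p * D))   ≡⟨ regroup (A + D) ((A + D) ^ p) (A ∸ (D + p * D)) ⟩
    (A + D) ^ p * ((A + D) * (A ∸ (D + p * D))) ≤⟨ *-monoʳ-≤ ((A + D) ^ p) (one-step (p * D)) ⟩
    (A + D) ^ p * (A * (A ∸ p * D))             ≡⟨ regroup′ ((A + D) ^ p) A (A ∸ p * D) ⟩
    (A + D) ^ p * (A ∸ p * D) * A               ≤⟨ *-monoˡ-≤ A (reverse-bernoulli A D p) ⟩
    A ^ p * A * A                               ≡⟨ cong (_* A) (*-comm (A ^ p) A) ⟩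
    A * A ^ p * A                               ∎
    where
    open ≤-Reasoning
    regroup : ∀ s t u → s * t * u ≡ t * (s * u)
    regroup = solve-∀
    regroup′ : ∀ s t u → s * (t * u) ≡ s * u * t
    regroup′ = solve-∀
    one-step : ∀ P → (A + D) * (A ∸ (D + P)) ≤ A * (A ∸ P)
    one-step P = begin
      (A + D) * (A ∸ (D + P))           ≡⟨ *-distribˡ-∸ (A + D) A (D + P) ⟩
      (A + D) * A ∸ (A + D) * (D + P)   ≤⟨ ∸-monoʳ-≤ ((A + D) * A) lower ⟩
      (A + D) * A ∸ (D * A + A * P)     ≡⟨ cong (_∸ (D * A + A * P)) (*-distribʳ-+ A A D) ⟩
      A * A + D * A ∸ (D * A + A * P)   ≡⟨ cong (_∸ (D * A + A * P)) (+-comm (A * A) (D * A)) ⟩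
      D * A + A * A ∸ (D * A + A * P)   ≡⟨ [m+n]∸[m+o]≡n∸o (D * A) (A * A) (A * P) ⟩
      A * A ∸ A * P                     ≡⟨ *-distribˡ-∸ A A P ⟨
      A * (A ∸ P)                       ∎
      where
      expand : ∀ A D P → (A + D) * (D + P) ≡ D * A + A * P + (D * D + D * P)
      expand = solve-∀
      lower : D * A + A * P ≤ (A + D) * (D + P)
      lower = ≤-trans (m≤m+n _ _) (≤-reflexive (sym (expand A D P)))

  -- (1 + D/A)^p ≤ A/R ≤ 1 + q Z/X ≤ (1 + Z/X)^q
  ^-ratio-comparison : ∀ {A D R X Z} p q → A ≡ p * D + R → .{{NonZero R}} → .{{NonZero X}} →
                       p * D * X ≤ q * Z * R → (A + D) ^ p * X ^ q ≤ A ^ p * (X + Z) ^ q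
  ^-ratio-comparison {A} {D} {R} {X} {Z} p q A≡ pDX≤qZR =
    *-cancelʳ-≤ _ _ (R * X) {{m*n≢0 R X}} (begin
      (A + D) ^ p * X ^ q * (R * X)           ≡⟨ regroup ((A + D) ^ p) (X ^ q) R X ⟩
      (A + D) ^ p * R * (X ^ q * X)           ≡⟨ cong (λ w → (A + D) ^ p * w * (X ^ q * X)) A∸pD≡R ⟨
      (A + D) ^ p * (A ∸ p * D) * (X ^ q * X) ≤⟨ *-monoˡ-≤ (X ^ q * X) (reverse-bernoulli A D p) ⟩
      A ^ p * A * (X ^ q * X)                 ≡⟨ regroup (A ^ p) A (X ^ q) X ⟩
      A ^ p * X ^ q * (A * X)                 ≤⟨ *-monoʳ-≤ (A ^ p * X ^ q) AX≤ ⟩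
      A ^ p * X ^ q * (R * (X + q * Z))       ≡⟨ regroup (A ^ p) (X ^ q) R (X + q * Z) ⟩
      A ^ p * R * (X ^ q * (X + q * Z))       ≤⟨ *-monoʳ-≤ (A ^ p * R) (bernoulli X Z q) ⟩
      A ^ p * R * ((X + Z) ^ q * X)           ≡⟨ regroup (A ^ p) R ((X + Z) ^ q) X ⟩
      A ^ p * (X + Z) ^ q * (R * X)           ∎)
    where
    open ≤-Reasoning
    regroup : ∀ s t u v → s * t * (u * v) ≡ s * u * (t * v)
    regroup = solve-∀
    A∸pD≡R : A ∸ p * D ≡ R
    A∸pD≡R = trans (cong (_∸ p * D) A≡) (m+n∸m≡n (p * D) R)
    AX≤ : A * X ≤ R * (X + q * Z)
    AX≤ = begin
      A * X                 ≡⟨ cong (_* X) A≡ ⟩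
      (p * D + R) * X       ≡⟨ *-distribʳ-+ X (p * D) R ⟩
      p * D * X + R * X     ≤⟨ +-monoˡ-≤ (R * X) pDX≤qZR ⟩
      q * Z * R + R * X     ≡⟨ rearrange q Z R X ⟩
      R * (X + q * Z)       ∎
      where
      rearrange : ∀ q Z R X → q * Z * R + R * X ≡ R * (X + q * Z)
      rearrange = solve-∀

  -- Bernoulli applied to the ⌊m/k⌋ blocks of length k in the exponent m.
  block-bernoulli : ∀ {X Z} m k .{{_ : NonZero k}} → Z ≤ X →
                    X ^ m * (suc (m / k) * Z) ^ k ≤ (X + Z) ^ m * X ^ k
  block-bernoulli {X} {Z} m k Z≤X = begin
    X ^ m * (suc M * Z) ^ k                        ≡⟨ cong (_* (suc M * Z) ^ k) (split X) ⟩
    X ^ r * (X ^ M) ^ k * (suc M * Z) ^ k          ≡⟨ *-assoc (X ^ r) _ _ ⟩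
    X ^ r * ((X ^ M) ^ k * (suc M * Z) ^ k)        ≡⟨ cong (X ^ r *_) (^-distribʳ-* (X ^ M) (suc M * Z) k) ⟨
    X ^ r * (X ^ M * (suc M * Z)) ^ k              ≤⟨ *-mono-≤ (^-monoˡ-≤ r (m≤m+n X Z)) (^-monoˡ-≤ k one-block) ⟩
    (X + Z) ^ r * ((X + Z) ^ M * X) ^ k            ≡⟨ cong ((X + Z) ^ r *_) (^-distribʳ-* ((X + Z) ^ M) X k) ⟩
    (X + Z) ^ r * (((X + Z) ^ M) ^ k * X ^ k)      ≡⟨ *-assoc ((X + Z) ^ r) _ _ ⟨
    (X + Z) ^ r * ((X + Z) ^ M) ^ k * X ^ k        ≡⟨ cong (_* X ^ k) (split (X + Z)) ⟨
    (X + Z) ^ m * X ^ k                            ∎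
    where
    open ≤-Reasoning
    M r : ℕ
    M = m / k
    r = m % k
    split : ∀ Y → Y ^ m ≡ Y ^ r * (Y ^ M) ^ k
    split Y = begin-equality
      Y ^ m               ≡⟨ cong (Y ^_) (m≡m%n+[m/n]*n m k) ⟩
      Y ^ (r + M * k)     ≡⟨ ^-distribˡ-+-* Y r (M * k) ⟩
      Y ^ r * Y ^ (M * k) ≡⟨ cong (Y ^ r *_) (^-*-assoc Y M k) ⟨
      Y ^ r * (Y ^ M) ^ k ∎
    one-block : X ^ M * (suc M * Z) ≤ (X + Z) ^ M * X
    one-block = ≤-trans (*-monoʳ-≤ (X ^ M) (begin
      suc M * Z  ≡⟨ +-comm Z (M * Z) ⟩
      M * Z + Z  ≤⟨ +-monoʳ-≤ (M * Z) Z≤X ⟩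
      M * Z + X  ≡⟨ +-comm (M * Z) X ⟩
      X + M * Z  ∎)) (bernoulli X Z M)

  m<[1+m/n]*n : ∀ m n .{{_ : NonZero n}} → m < suc (m / n) * n
  m<[1+m/n]*n m n = begin-strict
    m                  ≡⟨ m≡m%n+[m/n]*n m n ⟩
    m % n + m / n * n  <⟨ +-monoˡ-< (m / n * n) (m%n<n m n) ⟩
    suc (m / n) * n    ∎
    where open ≤-Reasoning

  -- a/b < β/α ≤ ζ/ξ ≤ d/c, cleared of denominators
  ratio-chain : ∀ {a b c d α β ξ ζ} .{{_ : NonZero (c * ξ)}} →
                a * α < b * β → β * ξ ≤ α * ζ → c * ζ ≤ d * ξ → a * c < b * d
  ratio-chain {a} {b} {c} {d} {α} {β} {ξ} {ζ} aα<bβ βξ≤αζ cζ≤dξ = *-cancelʳ-< (α * ξ) _ _ (begin-strict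
    a * c * (α * ξ)   ≡⟨ regroup a c α ξ ⟩
    a * α * (c * ξ)   <⟨ *-monoˡ-< (c * ξ) aα<bβ ⟩
    b * β * (c * ξ)   ≡⟨ regroup′ b β c ξ ⟩
    b * c * (β * ξ)   ≤⟨ *-monoʳ-≤ (b * c) βξ≤αζ ⟩
    b * c * (α * ζ)   ≡⟨ regroup b c α ζ ⟩
    b * α * (c * ζ)   ≤⟨ *-monoʳ-≤ (b * α) cζ≤dξ ⟩
    b * α * (d * ξ)   ≡⟨ regroup′ b α d ξ ⟩
    b * d * (α * ξ)   ∎)
    where
    open ≤-Reasoning
    regroup : ∀ a c α ξ → a * c * (α * ξ) ≡ a * α * (c * ξ)
    regroup = solve-∀
    regroup′ : ∀ b β c ξ → b * β * (c * ξ) ≡ b * c * (β * ξ)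
    regroup′ = solve-∀

module Counting where

  open import Data.Nat hiding (_≟_)
  open import Data.Nat.Properties hiding (_≟_)
  open import Data.Bool using (Bool; true; false; not; _∧_; _∨_)
  open import Data.Bool.Properties using (∨-identityʳ)
  open import Data.Fin using (Fin; zero; suc)
  open import Data.Fin.Properties using (_≟_)
  open import Data.Fin.Subset using (Subset; ∣_∣)
  open import Data.Vec as Vec using (Vec; []; _∷_; lookup; tabulate)
  open import Data.Product using (∃; _×_; _,_)
  open import Data.Sum using (_⊎_; inj₁; inj₂)
  open import Function using (_∘_)
  open import Relation.Nullary using (yes; no; does)
  open import Relation.Binary.PropositionalEquality
  open import Algebra.Properties.Semiring.Sum +-*-semiring public
    using (sum; sum-syntax; ∑-comm; ∑-distrib-+; *-distribˡ-sum; sum-cong-≗)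

  sum-mono-≤ : ∀ {n} {f g : Fin n → ℕ} → (∀ i → f i ≤ g i) → sum f ≤ sum g
  sum-mono-≤ {zero}  f≤g = z≤n
  sum-mono-≤ {suc n} f≤g = +-mono-≤ (f≤g zero) (sum-mono-≤ (f≤g ∘ suc))

  sum-const : ∀ n c → ∑[ i < n ] c ≡ n * c
  sum-const zero    c = refl
  sum-const (suc n) c = cong (c +_) (sum-const n c)

  sum-tabulate : ∀ {n} (f : Fin n → ℕ) → Vec.sum (tabulate f) ≡ sum f
  sum-tabulate {zero}  f = refl
  sum-tabulate {suc n} f = cong (f zero +_) (sum-tabulate (f ∘ suc))

  χ : Bool → ℕ
  χ true  = 1
  χ false = 0

  χ-∧ : ∀ a b → χ (a ∧ b) ≡ χ a * χ b
  χ-∧ true  b = sym (+-identityʳ (χ b))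
  χ-∧ false b = refl

  χ*≤ : ∀ b x → χ b * x ≤ x
  χ*≤ true  x = ≤-reflexive (+-identityʳ x)
  χ*≤ false x = z≤n

  χ-split : ∀ a b → χ a ≡ χ (a ∧ not b) + χ (a ∧ b)
  χ-split true  true  = refl
  χ-split true  false = refl
  χ-split false b     = refl

  card : ∀ {n} → (Fin n → Bool) → ℕ
  card p = sum (χ ∘ p)

  ∣∣≡card-lookup : ∀ {n} (p : Subset n) → ∣ p ∣ ≡ card (lookup p)
  ∣∣≡card-lookup []           = refl
  ∣∣≡card-lookup (true ∷ p)  = cong suc (∣∣≡card-lookup p)
  ∣∣≡card-lookup (false ∷ p) = ∣∣≡card-lookup p

  card-∅ : ∀ n → card {n} (λ _ → false) ≡ 0
  card-∅ n = trans (sum-const n 0) (*-zeroʳ n)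

  card-∁ : ∀ {n} (p : Fin n → Bool) → card p + card (not ∘ p) ≡ n
  card-∁ {zero}  p = refl
  card-∁ {suc n} p with p zero
  ... | true  = cong suc (card-∁ (p ∘ suc))
  ... | false = trans (+-suc (card (p ∘ suc)) _) (cong suc (card-∁ (p ∘ suc)))

  card-∁≡ : ∀ {n} (p : Fin n → Bool) {i} → card p ≡ i → card (not ∘ p) ≡ n ∸ i
  card-∁≡ {n} p ∣p∣≡i = trans (sym (m+n∸m≡n (card p) (card (not ∘ p)))) (cong₂ _∸_ (card-∁ p) ∣p∣≡i)

  card-insert : ∀ {n} (p : Fin n → Bool) u → p u ≡ false →
                card (λ w → p w ∨ does (w ≟ u)) ≡ suc (card p)
  card-insert {suc n} p zero pu≡false rewrite pu≡false =
    cong suc (sum-cong-≗ (λ w → cong χ (∨-identityʳ (p (suc w)))))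
  card-insert {suc n} p (suc u) pu≡false with p zero
  ... | true  = cong suc (card-insert (p ∘ suc) u pu≡false)
  ... | false = card-insert (p ∘ suc) u pu≡false

  insert-member : ∀ {n} (p : Fin n → Bool) u w → (p w ∨ does (w ≟ u)) ≡ true → p w ≡ true ⊎ w ≡ u
  insert-member p u w with p w | w ≟ u
  ... | true  | _       = λ _ → inj₁ refl
  ... | false | yes w≡u = λ _ → inj₂ w≡u

  card-subset : ∀ {n} (p : Fin n → Bool) t → t ≤ card p →
                ∃ λ q → (∀ v → q v ≡ true → p v ≡ true) × card q ≡ t
  card-subset {n}     p zero    _    = (λ _ → false) , (λ _ ()) , card-∅ n
  card-subset {suc n} p (suc t) t<∣p∣ with p zero in p₀
  ... | true with card-subset (p ∘ suc) t (≤-pred t<∣p∣)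
  ...   | q , q⊆p , ∣q∣ = (λ { zero → true ; (suc w) → q w })
                          , (λ { zero _ → p₀ ; (suc w) → q⊆p w }) , cong suc ∣q∣
  card-subset {suc n} p (suc t) t<∣p∣ | false with card-subset (p ∘ suc) (suc t) t<∣p∣
  ...   | q , q⊆p , ∣q∣ = (λ { zero → false ; (suc w) → q w })
                          , (λ { zero () ; (suc w) → q⊆p w }) , ∣q∣

  min-times-succ≤ : ∀ {x a b c S} → x ≤ a → x ≤ b → b * c ≤ S → x * suc c ≤ a + S
  min-times-succ≤ {x} {a} {b} {c} {S} x≤a x≤b bc≤S = begin
    x * suc c  ≡⟨ *-suc x c ⟩
    x + x * c  ≤⟨ +-mono-≤ x≤a (≤-trans (*-monoˡ-≤ c x≤b) bc≤S) ⟩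
    a + S      ∎
    where open ≤-Reasoning

  below-average : ∀ {n} (r : Fin n → Bool) (f : Fin n → ℕ) → 0 < card r →
                  ∃ λ u → r u ≡ true × f u * card r ≤ ∑[ w < n ] (χ (r w) * f w)
  below-average {suc n} r f 0<∣r∣ with r zero in r₀
  ... | false with below-average (r ∘ suc) (f ∘ suc) 0<∣r∣
  ...   | u , ru , avg = suc u , ru , avg
  below-average {suc n} r f 0<∣r∣ | true with card (r ∘ suc) | below-average (r ∘ suc) (f ∘ suc)
  ...   | zero  | _ = zero , r₀ , ≤-trans (≤-reflexive (*-identityʳ (f zero))) (≤-trans (m≤m+n _ 0) (m≤m+n _ _))
  ...   | suc c | below-average′ with below-average′ z<s
  ...     | u , ru , avg with f zero ≤? f (suc u)
  ...       | yes f₀≤ = zero , r₀ , min-times-succ≤ (m≤m+n _ 0) f₀≤ avg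
  ...       | no  f₀≰ = suc u , ru , min-times-succ≤ (≤-trans (<⇒≤ (≰⇒> f₀≰)) (m≤m+n _ 0)) ≤-refl avg

module Greedy where

  open import Data.Nat hiding (_≟_)
  open import Data.Nat.Properties hiding (_≟_)
  open import Data.Bool using (Bool; true; false; not; _∧_; _∨_)
  open import Data.Bool.Properties using (∧-conicalˡ; ∧-conicalʳ; not-injective)
  open import Data.Fin using (Fin; zero; suc)
  open import Data.Fin.Properties using (_≟_)
  open import Data.Fin.Subset using (_∈_; _∉_; ∣_∣)
  open import Data.Vec using (lookup; tabulate)
  open import Data.Vec.Properties using (lookup∘tabulate; []=⇒lookup)
  open import Data.Product using (Σ; ∃; _×_; _,_; proj₁; proj₂)
  open import Data.Sum using (inj₁; inj₂)
  open import Function using (_∘_)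
  open import Relation.Nullary using (¬_; yes; no; does; ofʸ; ofⁿ; contradiction)
  open import Relation.Unary using (Decidable)
  open import Relation.Binary.PropositionalEquality
  open import Data.Nat.Tactic.RingSolver
  open import Defs using (BipGraph; edgeCount; HasBiHole)
  open Counting

  last-success : ∀ {p} {P : ℕ → Set p} → Decidable P → ∀ N → P 0 → ¬ P N →
                 ∃ λ s → P s × ¬ P (suc s)
  last-success P? zero    P0 ¬PN = contradiction P0 ¬PN
  last-success P? (suc N) P0 ¬PN with P? N
  ... | yes PN   = N , PN , ¬PN
  ... | no  ¬PN′ = last-success P? N P0 ¬PN′

  deletion-bound : ∀ {y y′ f} c D → y ≡ y′ + f → f * c ≤ D * y → y * (c ∸ D) ≤ y′ * c
  deletion-bound {y} {y′} {f} c D y≡y′+f fc≤Dy = begin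
    y * (c ∸ D)              ≡⟨ *-distribˡ-∸ y c D ⟩
    y * c ∸ y * D            ≤⟨ ∸-monoʳ-≤ (y * c) (≤-trans fc≤Dy (≤-reflexive (*-comm D y))) ⟩
    y * c ∸ f * c            ≡⟨ cong (λ w → w * c ∸ f * c) y≡y′+f ⟩
    (y′ + f) * c ∸ f * c     ≡⟨ cong (_∸ f * c) (*-distribʳ-+ c y′ f) ⟩
    y′ * c + f * c ∸ f * c   ≡⟨ m+n∸n≡m (y′ * c) (f * c) ⟩
    y′ * c                   ∎
    where open ≤-Reasoning

  module BiHoleGreedy {n} (G : BipGraph n) (D : ℕ) where

    adj : Fin n → Fin n → Bool
    adj u v = lookup (G u) v

    deg : Fin n → ℕ
    deg v = ∑[ u < n ] χ (adj u v)

    low : Fin n → Bool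
    low v = deg v ≤ᵇ D

    lowCount : ℕ
    lowCount = card low

    low⇒deg≤ : ∀ v → low v ≡ true → deg v ≤ D
    low⇒deg≤ v with deg v ≤ᵇ D | ≤ᵇ-reflects-≤ (deg v) D
    ... | true | ofʸ deg≤D = λ _ → deg≤D

    edgeCount≡∑deg : edgeCount G ≡ ∑[ v < n ] deg v
    edgeCount≡∑deg = begin
      edgeCount G                          ≡⟨ sum-tabulate (λ u → ∣ G u ∣) ⟩
      ∑[ u < n ] ∣ G u ∣   ≡⟨ sum-cong-≗ (λ u → ∣∣≡card-lookup (G u)) ⟩
      ∑[ u < n ] ∑[ v < n ] χ (adj u v)    ≡⟨ ∑-comm (λ u v → χ (adj u v)) ⟩
      ∑[ v < n ] deg v                     ∎
      where open ≡-Reasoning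

    markov : n * suc D ≤ edgeCount G + lowCount * suc D
    markov = begin
      n * suc D                                       ≡⟨ sum-const n (suc D) ⟨
      ∑[ v < n ] suc D                                ≤⟨ sum-mono-≤ per-vertex ⟩
      ∑[ v < n ] (deg v + χ (low v) * suc D)          ≡⟨ ∑-distrib-+ deg (λ v → χ (low v) * suc D) ⟩
      ∑[ v < n ] deg v + ∑[ v < n ] (χ (low v) * suc D)
        ≡⟨ cong₂ _+_ (sym edgeCount≡∑deg) (sum-cong-≗ (λ v → *-comm (χ (low v)) (suc D))) ⟩
      edgeCount G + ∑[ v < n ] (suc D * χ (low v))    ≡⟨ cong (edgeCount G +_) (*-distribˡ-sum (suc D) (χ ∘ low)) ⟨
      edgeCount G + suc D * lowCount                  ≡⟨ cong (edgeCount G +_) (*-comm (suc D) lowCount) ⟩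
      edgeCount G + lowCount * suc D                  ∎
      where
      open ≤-Reasoning
      per-vertex : ∀ v → suc D ≤ deg v + χ (low v) * suc D
      per-vertex v with deg v ≤ᵇ D | ≤ᵇ-reflects-≤ (deg v) D
      ... | true  | ofʸ _     = ≤-trans (m≤m+n (suc D) 0) (m≤n+m _ (deg v))
      ... | false | ofⁿ deg≰D = ≤-trans (≰⇒> deg≰D) (m≤m+n (deg v) 0)

    neighbours-in : (Fin n → Bool) → Fin n → ℕ
    neighbours-in Y u = card (λ v → Y v ∧ adj u v)

    ∑-neighbours-in≤ : ∀ Y → (∀ v → Y v ≡ true → deg v ≤ D) → ∑[ u < n ] neighbours-in Y u ≤ D * card Y
    ∑-neighbours-in≤ Y Y-low = begin
      ∑[ u < n ] ∑[ v < n ] χ (Y v ∧ adj u v)   ≡⟨ ∑-comm (λ u v → χ (Y v ∧ adj u v)) ⟩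
      ∑[ v < n ] ∑[ u < n ] χ (Y v ∧ adj u v)   ≡⟨ sum-cong-≗ restricted-deg ⟩
      ∑[ v < n ] (χ (Y v) * deg v)              ≤⟨ sum-mono-≤ per-vertex ⟩
      ∑[ v < n ] (D * χ (Y v))                  ≡⟨ *-distribˡ-sum D (χ ∘ Y) ⟨
      D * card Y                                ∎
      where
      open ≤-Reasoning
      restricted-deg : ∀ v → ∑[ u < n ] χ (Y v ∧ adj u v) ≡ χ (Y v) * deg v
      restricted-deg v = trans (sum-cong-≗ (λ u → χ-∧ (Y v) (adj u v))) (sym (*-distribˡ-sum (χ (Y v)) (λ u → χ (adj u v))))
      per-vertex : ∀ v → χ (Y v) * deg v ≤ D * χ (Y v)
      per-vertex v with Y v in Yv
      ... | true  = ≤-trans (≤-reflexive (+-identityʳ (deg v))) (≤-trans (Y-low v Yv) (≤-reflexive (sym (*-identityʳ D))))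
      ... | false = z≤n

    falling falling-D : ℕ → ℕ
    falling zero      = 1
    falling (suc i)   = falling i * (n ∸ i)
    falling-D zero    = 1
    falling-D (suc i) = falling-D i * (n ∸ i ∸ D)

    -- ∣Y∣-large reads |Y| ≥ lowCount ∏_{j<i} (n-j-D)/(n-j).
    record Stage (i : ℕ) : Set where
      field
        X Y       : Fin n → Bool
        ∣X∣≡i     : card X ≡ i
        Y-low     : ∀ v → Y v ≡ true → deg v ≤ D
        no-edge   : ∀ u v → X u ≡ true → Y v ≡ true → adj u v ≡ false
        ∣Y∣-large : lowCount * falling-D i ≤ card Y * falling i

    initial : Stage 0
    initial = record
      { X = λ _ → false ; Y = low ; ∣X∣≡i = card-∅ n
      ; Y-low = low⇒deg≤ ; no-edge = λ _ _ () ; ∣Y∣-large = ≤-refl }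

    few-neighbours-outside : ∀ {i} (X Y : Fin n → Bool) → card X ≡ i → i < n → (∀ v → Y v ≡ true → deg v ≤ D) →
                             ∃ λ u → X u ≡ false × neighbours-in Y u * (n ∸ i) ≤ D * card Y
    few-neighbours-outside {i} X Y ∣X∣≡i i<n Y-low
      with below-average (not ∘ X) (neighbours-in Y) (subst (0 <_) (sym (card-∁≡ X ∣X∣≡i)) (m<n⇒0<n∸m i<n))
    ... | u , u∉X , below = u , not-injective u∉X , (begin
      neighbours-in Y u * (n ∸ i)                      ≡⟨ cong (neighbours-in Y u *_) (card-∁≡ X ∣X∣≡i) ⟨
      neighbours-in Y u * card (not ∘ X)               ≤⟨ below ⟩
      ∑[ w < n ] (χ (not (X w)) * neighbours-in Y w)   ≤⟨ sum-mono-≤ (λ w → χ*≤ (not (X w)) (neighbours-in Y w)) ⟩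
      ∑[ w < n ] neighbours-in Y w                     ≤⟨ ∑-neighbours-in≤ Y Y-low ⟩
      D * card Y                                       ∎)
      where open ≤-Reasoning

    extend : ∀ {i} (st : Stage i) → let open Stage st in
             ∀ u → X u ≡ false → neighbours-in Y u * (n ∸ i) ≤ D * card Y → Stage (suc i)
    extend {i} st u u∉X few = record
      { X = λ w → X w ∨ does (w ≟ u)
      ; Y = Y′
      ; ∣X∣≡i = trans (card-insert X u u∉X) (cong suc ∣X∣≡i)
      ; Y-low = λ v v∈Y′ → Y-low v (∧-conicalˡ (Y v) _ v∈Y′)
      ; no-edge = no-edge′
      ; ∣Y∣-large = ∣Y′∣-large }
      where
      open Stage st
      Y′ : Fin n → Bool
      Y′ v = Y v ∧ not (adj u v)
      no-edge′ : ∀ w v → (X w ∨ does (w ≟ u)) ≡ true → Y′ v ≡ true → adj w v ≡ false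
      no-edge′ w v w∈X′ v∈Y′ with insert-member X u w w∈X′
      ... | inj₁ w∈X  = no-edge w v w∈X (∧-conicalˡ (Y v) _ v∈Y′)
      ... | inj₂ refl = not-injective (∧-conicalʳ (Y v) _ v∈Y′)
      ∣Y∣≡ : card Y ≡ card Y′ + neighbours-in Y u
      ∣Y∣≡ = trans (sum-cong-≗ (λ v → χ-split (Y v) (adj u v))) (∑-distrib-+ (χ ∘ Y′) (λ v → χ (Y v ∧ adj u v)))
      ∣Y′∣-bound : card Y * (n ∸ i ∸ D) ≤ card Y′ * (n ∸ i)
      ∣Y′∣-bound = deletion-bound {y′ = card Y′} {neighbours-in Y u} (n ∸ i) D ∣Y∣≡ few
      ∣Y′∣-large : lowCount * (falling-D i * (n ∸ i ∸ D)) ≤ card Y′ * (falling i * (n ∸ i))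
      ∣Y′∣-large = begin
        lowCount * (falling-D i * (n ∸ i ∸ D))   ≡⟨ *-assoc lowCount (falling-D i) _ ⟨
        lowCount * falling-D i * (n ∸ i ∸ D)     ≤⟨ *-monoˡ-≤ (n ∸ i ∸ D) ∣Y∣-large ⟩
        card Y * falling i * (n ∸ i ∸ D)         ≡⟨ swap (card Y) (falling i) (n ∸ i ∸ D) ⟩
        card Y * (n ∸ i ∸ D) * falling i         ≤⟨ *-monoˡ-≤ (falling i) ∣Y′∣-bound ⟩
        card Y′ * (n ∸ i) * falling i            ≡⟨ swap′ (card Y′) (n ∸ i) (falling i) ⟩
        card Y′ * (falling i * (n ∸ i))          ∎
        where
        open ≤-Reasoning
        swap : ∀ a b c → a * b * c ≡ a * c * b
        swap = solve-∀
        swap′ : ∀ a b c → a * b * c ≡ a * (c * b)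
        swap′ = solve-∀

    step : ∀ {i} → i < n → Stage i → Stage (suc i)
    step i<n st =
      let (u , u∉X , few) = few-neighbours-outside X Y ∣X∣≡i i<n Y-low in extend st u u∉X few
      where open Stage st

    run : ∀ i → i ≤ n → Stage i
    run zero    _   = initial
    run (suc i) i<n = step i<n (run i (≤-trans (n≤1+n i) i<n))

    falling>0 : ∀ i → i ≤ n → 0 < falling i
    falling>0 zero    _   = z<s
    falling>0 (suc i) i<n = *-mono-< (falling>0 i (≤-trans (n≤1+n i) i<n)) (m<n⇒0<n∸m i<n)

    Feasible : ℕ → Set
    Feasible m = m ≤ n × m * falling m ≤ lowCount * falling-D m

    feasible? : Decidable Feasible
    feasible? m with m ≤? n | m * falling m ≤? lowCount * falling-D m
    ... | yes m≤n | yes bound = yes (m≤n , bound)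
    ... | no  m≰n | _         = no (m≰n ∘ proj₁)
    ... | yes _   | no  ¬bound = no (¬bound ∘ proj₂)

    feasible⇒bihole : ∀ {m} → Feasible m → HasBiHole G m
    feasible⇒bihole {m} (m≤n , bound) =
      tabulate X , tabulate Y″ , trans (∣tabulate∣ X) ∣X∣≡i , trans (∣tabulate∣ Y″) ∣Y″∣ , no-edge″
      where
      open Stage (run m m≤n)
      m≤∣Y∣ : m ≤ card Y
      m≤∣Y∣ = *-cancelʳ-≤ m (card Y) (falling m) {{>-nonZero (falling>0 m m≤n)}} (≤-trans bound ∣Y∣-large)
      Y″ : Fin n → Bool
      Y″ = proj₁ (card-subset Y m m≤∣Y∣)
      Y″⊆Y : ∀ v → Y″ v ≡ true → Y v ≡ true
      Y″⊆Y = proj₁ (proj₂ (card-subset Y m m≤∣Y∣))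
      ∣Y″∣ : card Y″ ≡ m
      ∣Y″∣ = proj₂ (proj₂ (card-subset Y m m≤∣Y∣))
      ∣tabulate∣ : ∀ p → ∣ tabulate p ∣ ≡ card p
      ∣tabulate∣ p = trans (∣∣≡card-lookup (tabulate p)) (sum-cong-≗ (λ i → cong χ (lookup∘tabulate p i)))
      ∈tabulate : ∀ p {u} → u ∈ tabulate p → p u ≡ true
      ∈tabulate p {u} u∈p = trans (sym (lookup∘tabulate p u)) ([]=⇒lookup u∈p)
      no-edge″ : ∀ u v → u ∈ tabulate X → v ∈ tabulate Y″ → v ∉ G u
      no-edge″ u v u∈X v∈Y″ v∈Gu with trans (sym ([]=⇒lookup v∈Gu)) (no-edge u v (∈tabulate X u∈X) (Y″⊆Y v (∈tabulate Y″ v∈Y″)))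
      ... | ()

    -- (n-j)/(n-j-D) ≤ c/(c-D) for every factor with c ≤ n - j
    falling-ratio : ∀ c i → c + i ≤ suc n → falling i * (c ∸ D) ^ i ≤ falling-D i * c ^ i
    falling-ratio c zero    _          = ≤-refl
    falling-ratio c (suc i) c+i<n+1 = begin
      falling i * (n ∸ i) * ((c ∸ D) * (c ∸ D) ^ i)        ≡⟨ regroup (falling i) (n ∸ i) (c ∸ D) ((c ∸ D) ^ i) ⟩
      falling i * (c ∸ D) ^ i * ((n ∸ i) * (c ∸ D))        ≤⟨ *-mono-≤ (falling-ratio c i (≤-trans c+i≤n (n≤1+n n))) factor ⟩
      falling-D i * c ^ i * ((n ∸ i ∸ D) * c)              ≡⟨ regroup′ (falling-D i) (c ^ i) (n ∸ i ∸ D) c ⟩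
      falling-D i * (n ∸ i ∸ D) * (c * c ^ i)              ∎
      where
      open ≤-Reasoning
      regroup : ∀ a b c d → a * b * (c * d) ≡ a * d * (b * c)
      regroup = solve-∀
      regroup′ : ∀ a b c d → a * b * (c * d) ≡ a * c * (d * b)
      regroup′ = solve-∀
      c+i≤n : c + i ≤ n
      c+i≤n = ≤-pred (subst (_≤ suc n) (+-suc c i) c+i<n+1)
      c≤n∸i : c ≤ n ∸ i
      c≤n∸i = subst (_≤ n ∸ i) (m+n∸n≡m c i) (∸-monoˡ-≤ i c+i≤n)
      factor : (n ∸ i) * (c ∸ D) ≤ (n ∸ i ∸ D) * c
      factor = begin
        (n ∸ i) * (c ∸ D)           ≡⟨ *-distribˡ-∸ (n ∸ i) c D ⟩
        (n ∸ i) * c ∸ (n ∸ i) * D   ≤⟨ ∸-monoʳ-≤ ((n ∸ i) * c) (≤-trans (*-monoʳ-≤ D c≤n∸i) (≤-reflexive (*-comm D (n ∸ i)))) ⟩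
        (n ∸ i) * c ∸ D * c         ≡⟨ *-distribʳ-∸ c (n ∸ i) D ⟨
        (n ∸ i ∸ D) * c             ∎

    infeasible⇒bound : ∀ s → ¬ Feasible (suc s) → suc s + D ≤ n →
                       lowCount * (n ∸ s ∸ D) ^ suc s < suc s * (n ∸ s) ^ suc s
    infeasible⇒bound s infeasible m+D≤n = *-cancelʳ-< (falling m) _ _ (begin-strict
      lowCount * (c ∸ D) ^ m * falling m     ≡⟨ regroup lowCount ((c ∸ D) ^ m) (falling m) ⟩
      lowCount * (falling m * (c ∸ D) ^ m)   ≤⟨ *-monoʳ-≤ lowCount (falling-ratio c m c+m≤n+1) ⟩
      lowCount * (falling-D m * c ^ m)       ≡⟨ *-assoc lowCount (falling-D m) (c ^ m) ⟨
      lowCount * falling-D m * c ^ m         <⟨ *-monoˡ-< (c ^ m) {{m^n≢0 c m {{>-nonZero c>0}}}} (≰⇒> (infeasible ∘ (m≤n ,_))) ⟩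
      m * falling m * c ^ m                  ≡⟨ regroup′ m (falling m) (c ^ m) ⟩
      m * c ^ m * falling m                  ∎)
      where
      open ≤-Reasoning
      m c : ℕ
      m = suc s
      c = n ∸ s
      regroup : ∀ a b c → a * b * c ≡ a * (c * b)
      regroup = solve-∀
      regroup′ : ∀ a b c → a * b * c ≡ a * c * b
      regroup′ = solve-∀
      m≤n : m ≤ n
      m≤n = ≤-trans (m≤m+n m D) m+D≤n
      c+m≤n+1 : c + m ≤ suc n
      c+m≤n+1 = ≤-reflexive (trans (+-suc c s) (cong suc (m∸n+n≡m (≤-trans (n≤1+n s) m≤n))))
      c>0 : 0 < c
      c>0 = m<n⇒0<n∸m m≤n

    greedy-bihole : Σ ℕ λ s → HasBiHole G s ×
                    (suc s + D ≤ n → lowCount * (n ∸ s ∸ D) ^ suc s < suc s * (n ∸ s) ^ suc s)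
    greedy-bihole with last-success feasible? (suc n) (z≤n , z≤n) (λ (n+1≤n , _) → 1+n≰n n+1≤n)
    ... | s , feasible , infeasible = s , feasible⇒bihole feasible , infeasible⇒bound s infeasible

module GrowthBound where

  open import Data.Nat
  open import Data.Nat.Properties
  open import Data.Nat.DivMod using (_/_)
  open import Data.Empty using (⊥)
  open import Relation.Binary.PropositionalEquality
  open import Data.Nat.Tactic.RingSolver
  open PowerInequalities

  -- a/b = 1 + 1/b is the loss allowed by ε, D ≈ (q+1)Δ/q is the degree threshold, and
  -- p = q + 2 is both the exponent in (1 + D/A)^p ≤ (1 + Z/X)^q and the block length.
  module Constants (b : ℕ) where
    a q p : ℕ
    a = suc b
    q = 4 * a
    p = 2 + q

    Δ₀ : ℕ
    Δ₀ = (16 * a * p) ^ p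

    Δ₀>0 : 0 < Δ₀
    Δ₀>0 = m^n>0 (16 * a * p) p

    N₀ : ℕ → ℕ
    N₀ Δ⁺ = 32 * a * suc p * suc Δ⁺

    [q+1]p≤16ap : suc q * p ≤ 16 * a * p
    [q+1]p≤16ap = *-monoˡ-≤ p (≤-trans (m≤m+n (suc q) (12 * b + 11)) (≤-reflexive (expand b)))
      where
      expand : ∀ b → suc (4 * suc b) + (12 * b + 11) ≡ 16 * suc b
      expand = solve-∀

    p[q+1]b≤qa[4b+3] : p * suc q * b ≤ q * a * (4 * b + 3)
    p[q+1]b≤qa[4b+3] = ≤-trans (m≤m+n _ (10 * b + 12)) (≤-reflexive (expand b))
      where
      expand : ∀ b → (2 + 4 * suc b) * suc (4 * suc b) * b + (10 * b + 12) ≡ 4 * suc b * suc b * (4 * b + 3)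
      expand = solve-∀

  module Growth (b : ℕ) .{{_ : NonZero b}} where
    open Constants b

    module _ (n E y₀ D s : ℕ) .{{_ : NonZero n}}
      (E-large  : Δ₀ * n ≤ E)
      (E-sparse : 32 * a * suc p * E ≤ n * n)
      (D-bound  : D * (q * n) ≤ E * suc q)
      (y₀-large : n < y₀ * suc q)
      (failure  : suc s + D ≤ n → y₀ * (n ∸ s ∸ D) ^ suc s < suc s * (n ∸ s) ^ suc s)
      where

      m X Z : ℕ
      m = suc s
      X = b * (n * n)
      Z = a * E

      instance
        E≢0 : NonZero E
        E≢0 = >-nonZero (≤-trans (*-mono-≤ Δ₀>0 (>-nonZero⁻¹ n)) E-large)
        n²≢0 : NonZero (n * n)
        n²≢0 = m*n≢0 n n
        X≢0 : NonZero X
        X≢0 = m*n≢0 b (n * n)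
        qn≢0 : NonZero (q * n)
        qn≢0 = m*n≢0 q n

      Z≤X : Z ≤ X
      Z≤X = begin
        a * E                  ≤⟨ *-monoˡ-≤ E (m≤m*n a (32 * suc p)) ⟩
        a * (32 * suc p) * E   ≡⟨ cong (_* E) (swap a 32 (suc p)) ⟩
        32 * a * suc p * E     ≤⟨ E-sparse ⟩
        n * n                  ≤⟨ m≤n*m (n * n) b ⟩
        X                      ∎
        where
        open ≤-Reasoning
        swap : ∀ x y z → x * (y * z) ≡ y * x * z
        swap = solve-∀

      Dn≤2E : D * n ≤ 2 * E
      Dn≤2E = *-cancelʳ-≤ (D * n) (2 * E) q (begin
        D * n * q          ≡⟨ swap D n q ⟩
        D * (q * n)        ≤⟨ D-bound ⟩
        E * suc q          ≤⟨ *-monoʳ-≤ E (+-monoˡ-≤ q (>-nonZero⁻¹ q)) ⟩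
        E * (q + q)        ≡⟨ swap′ E q ⟩
        2 * E * q          ∎)
        where
        open ≤-Reasoning
        swap : ∀ D n q → D * n * q ≡ D * (q * n)
        swap = solve-∀
        swap′ : ∀ E q → E * (q + q) ≡ 2 * E * q
        swap′ = solve-∀

      D-small : 16 * a * suc p * D ≤ n
      D-small = *-cancelʳ-≤ _ _ n (begin
        16 * a * suc p * D * n     ≡⟨ *-assoc (16 * a * suc p) D n ⟩
        16 * a * suc p * (D * n)   ≤⟨ *-monoʳ-≤ (16 * a * suc p) Dn≤2E ⟩
        16 * a * suc p * (2 * E)   ≡⟨ regroup a (suc p) E ⟩
        32 * a * suc p * E         ≤⟨ E-sparse ⟩
        n * n                      ∎)
        where
        open ≤-Reasoning
        regroup : ∀ a k E → 16 * a * k * (2 * E) ≡ 32 * a * k * E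
        regroup = solve-∀

      module _ (slow : n * (X + Z) ^ m ≤ E * X ^ m) where

        M : ℕ
        M = m / p

        one-block-bound : n * (suc M * Z) ^ p ≤ E * X ^ p
        one-block-bound = *-cancelˡ-≤ (X ^ m) {{m^n≢0 X m}} (begin
          X ^ m * (n * (suc M * Z) ^ p)   ≡⟨ x*[y*z]≡y*[x*z] (X ^ m) n _ ⟩
          n * (X ^ m * (suc M * Z) ^ p)   ≤⟨ *-monoʳ-≤ n (block-bernoulli m p Z≤X) ⟩
          n * ((X + Z) ^ m * X ^ p)       ≡⟨ *-assoc n _ _ ⟨
          n * (X + Z) ^ m * X ^ p         ≤⟨ *-monoˡ-≤ (X ^ p) slow ⟩
          E * X ^ m * X ^ p               ≡⟨ trans (*-assoc E _ _) (x*[y*z]≡y*[x*z] E (X ^ m) _) ⟩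
          X ^ m * (E * X ^ p)             ∎)
          where
          open ≤-Reasoning
          x*[y*z]≡y*[x*z] : ∀ x y z → x * (y * z) ≡ y * (x * z)
          x*[y*z]≡y*[x*z] = solve-∀

        few-blocks : suc M ^ p * E ^ suc q ≤ n ^ suc q * n ^ p
        few-blocks = *-cancelˡ-≤ (n * E * a ^ p) {{m*n≢0 (n * E) (a ^ p) {{m*n≢0 n E}} {{m^n≢0 a p}}}} (begin
          n * E * a ^ p * (suc M ^ p * E ^ suc q)        ≡⟨ regroup n E (a ^ p) (suc M ^ p) (E ^ suc q) ⟩
          n * (suc M ^ p * (a ^ p * E ^ p))              ≡⟨ cong (λ w → n * (suc M ^ p * w)) (^-distribʳ-* a E p) ⟨
          n * (suc M ^ p * (a * E) ^ p)                  ≡⟨ cong (n *_) (^-distribʳ-* (suc M) Z p) ⟨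
          n * (suc M * Z) ^ p                            ≤⟨ one-block-bound ⟩
          E * X ^ p                                      ≡⟨ cong (E *_) (trans (^-distribʳ-* b (n * n) p) (cong (b ^ p *_) (^-distribʳ-* n n p))) ⟩
          E * (b ^ p * (n ^ p * n ^ p))                  ≤⟨ *-monoʳ-≤ E (*-monoˡ-≤ (n ^ p * n ^ p) (^-monoˡ-≤ p (n≤1+n b))) ⟩
          E * (a ^ p * (n ^ p * n ^ p))                  ≡⟨ regroup′ n E (a ^ p) (n ^ suc q) (n ^ p) ⟩
          n * E * a ^ p * (n ^ suc q * n ^ p)            ∎)
          where
          open ≤-Reasoning
          regroup : ∀ n E ap Mp Eq → n * E * ap * (Mp * Eq) ≡ n * (Mp * (ap * (E * Eq)))
          regroup = solve-∀
          regroup′ : ∀ n E ap nq np → E * (ap * (n * nq * np)) ≡ n * E * ap * (nq * np)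
          regroup′ = solve-∀

        m<p[1+M] : m < p * suc M
        m<p[1+M] = subst (m <_) (*-comm (suc M) p) (m<[1+m/n]*n m p)

        m-small : 16 * a * m ≤ n
        m-small = ≮⇒≥ λ n<16am → <⇒≱ (E^[q+1]<G^p*n^[q+1] n<16am) G^p*n^[q+1]≤E^[q+1]
          where
          open ≤-Reasoning
          G : ℕ
          G = 16 * a * p
          E^[q+1]<G^p*n^[q+1] : n < 16 * a * m → E ^ suc q < G ^ p * n ^ suc q
          E^[q+1]<G^p*n^[q+1] n<16am = *-cancelʳ-< (n ^ p) _ _ (begin-strict
            E ^ suc q * n ^ p                ≡⟨ *-comm (E ^ suc q) (n ^ p) ⟩
            n ^ p * E ^ suc q                <⟨ *-monoˡ-< (E ^ suc q) {{m^n≢0 E (suc q)}} (^-monoˡ-< p n<G[1+M]) ⟩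
            (G * suc M) ^ p * E ^ suc q      ≡⟨ cong (_* E ^ suc q) (^-distribʳ-* G (suc M) p) ⟩
            G ^ p * suc M ^ p * E ^ suc q    ≡⟨ *-assoc (G ^ p) _ _ ⟩
            G ^ p * (suc M ^ p * E ^ suc q)  ≤⟨ *-monoʳ-≤ (G ^ p) few-blocks ⟩
            G ^ p * (n ^ suc q * n ^ p)      ≡⟨ *-assoc (G ^ p) _ _ ⟨
            G ^ p * n ^ suc q * n ^ p        ∎)
            where
            n<G[1+M] : n < G * suc M
            n<G[1+M] = <-≤-trans n<16am (begin
              16 * a * m            ≤⟨ *-monoʳ-≤ (16 * a) (<⇒≤ m<p[1+M]) ⟩
              16 * a * (p * suc M)  ≡⟨ *-assoc (16 * a) p (suc M) ⟨
              G * suc M             ∎)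
          G^p*n^[q+1]≤E^[q+1] : G ^ p * n ^ suc q ≤ E ^ suc q
          G^p*n^[q+1]≤E^[q+1] = begin
            G ^ p * n ^ suc q             ≤⟨ *-monoˡ-≤ (n ^ suc q) (m≤m*n (G ^ p) ((G ^ p) ^ q) {{m^n≢0 (G ^ p) q {{m^n≢0 G p}}}}) ⟩
            (G ^ p) ^ suc q * n ^ suc q   ≡⟨ ^-distribʳ-* (G ^ p) n (suc q) ⟨
            (G ^ p * n) ^ suc q           ≤⟨ ^-monoˡ-≤ (suc q) E-large ⟩
            E ^ suc q                     ∎

        T R A : ℕ
        T = m + suc p * D
        R = suc n ∸ T
        A = n ∸ s ∸ D

        4aT≤n : 4 * a * T ≤ n
        4aT≤n = *-cancelˡ-≤ 4 (begin
          4 * (4 * a * T)                      ≡⟨ expand a m (suc p) D ⟩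
          16 * a * m + 16 * a * suc p * D      ≤⟨ +-mono-≤ m-small D-small ⟩
          n + n                                ≤⟨ m≤m+n (n + n) (n + n) ⟩
          n + n + (n + n)                      ≡⟨ double n ⟩
          4 * n                                ∎)
          where
          open ≤-Reasoning
          expand : ∀ a m k D → 4 * (4 * a * (m + k * D)) ≡ 16 * a * m + 16 * a * k * D
          expand = solve-∀
          double : ∀ n → n + n + (n + n) ≡ 4 * n
          double = solve-∀

        T≤n : T ≤ n
        T≤n = ≤-trans (m≤n*m T (4 * a)) 4aT≤n

        instance
          R≢0 : NonZero R
          R≢0 = >-nonZero (m<n⇒0<n∸m (s≤s T≤n))

        n+1≡T+R : suc n ≡ m + (D + (p * D + R))
        n+1≡T+R = trans (sym (m+[n∸m]≡n (≤-trans T≤n (n≤1+n n)))) (reassoc m D (p * D) R)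
          where
          reassoc : ∀ m D pD R → m + (D + pD) + R ≡ m + (D + (pD + R))
          reassoc = solve-∀

        A≡pD+R : A ≡ p * D + R
        A≡pD+R = begin
          suc n ∸ m ∸ D                          ≡⟨ cong (λ w → w ∸ m ∸ D) n+1≡T+R ⟩
          m + (D + (p * D + R)) ∸ m ∸ D          ≡⟨ cong (_∸ D) (m+n∸m≡n m _) ⟩
          D + (p * D + R) ∸ D                    ≡⟨ m+n∸m≡n D _ ⟩
          p * D + R                              ∎
          where open ≡-Reasoning

        n∸s≡A+D : n ∸ s ≡ A + D
        n∸s≡A+D = begin
          suc n ∸ m                              ≡⟨ cong (_∸ m) n+1≡T+R ⟩
          m + (D + (p * D + R)) ∸ m              ≡⟨ m+n∸m≡n m _ ⟩
          D + (p * D + R)                        ≡⟨ +-comm D _ ⟩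
          p * D + R + D                          ≡⟨ cong (_+ D) A≡pD+R ⟨
          A + D                                  ∎
          where open ≡-Reasoning

        m+D≤n : m + D ≤ n
        m+D≤n = ≤-trans (+-monoʳ-≤ m (m≤m+n D (p * D))) T≤n

        [4b+3]n≤4aR : (4 * b + 3) * n ≤ 4 * a * R
        [4b+3]n≤4aR = +-cancelʳ-≤ n _ _ (begin
          (4 * b + 3) * n + n        ≡⟨ expand b n ⟩
          4 * a * n                  ≤⟨ m≤m+n (4 * a * n) (4 * a) ⟩
          4 * a * n + 4 * a          ≡⟨ expand′ (4 * a) n ⟩
          4 * a * suc n              ≡⟨ cong (4 * a *_) (m+[n∸m]≡n (≤-trans T≤n (n≤1+n n))) ⟨
          4 * a * (T + R)            ≡⟨ *-distribˡ-+ (4 * a) T R ⟩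
          4 * a * T + 4 * a * R      ≤⟨ +-monoˡ-≤ (4 * a * R) 4aT≤n ⟩
          n + 4 * a * R              ≡⟨ +-comm n _ ⟩
          4 * a * R + n              ∎)
          where
          open ≤-Reasoning
          expand : ∀ b n → (4 * b + 3) * n + n ≡ 4 * suc b * n
          expand = solve-∀
          expand′ : ∀ c n → c * n + c ≡ c * suc n
          expand′ = solve-∀

        pDX≤qZR : p * D * X ≤ q * Z * R
        pDX≤qZR = *-cancelʳ-≤ _ _ (q * n) (begin
          p * D * X * (q * n)                         ≡⟨ regroup p D X (q * n) ⟩
          p * X * (D * (q * n))                       ≤⟨ *-monoʳ-≤ (p * X) D-bound ⟩
          p * X * (E * suc q)                         ≡⟨ regroup′ p (suc q) b E n ⟩
          p * suc q * b * (E * (n * n))               ≤⟨ *-monoˡ-≤ (E * (n * n)) p[q+1]b≤qa[4b+3] ⟩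
          q * a * (4 * b + 3) * (E * (n * n))         ≡⟨ regroup″ q a (4 * b + 3) E n ⟩
          q * Z * ((4 * b + 3) * n) * n               ≤⟨ *-monoˡ-≤ n (*-monoʳ-≤ (q * Z) [4b+3]n≤4aR) ⟩
          q * Z * (4 * a * R) * n                     ≡⟨ regroup‴ (q * Z) (4 * a) R n ⟩
          q * Z * R * (q * n)                         ∎)
          where
          open ≤-Reasoning
          regroup : ∀ p D X c → p * D * X * c ≡ p * X * (D * c)
          regroup = solve-∀
          regroup′ : ∀ p s b E n → p * (b * (n * n)) * (E * s) ≡ p * s * b * (E * (n * n))
          regroup′ = solve-∀
          regroup″ : ∀ q a c E n → q * a * c * (E * (n * n)) ≡ q * (a * E) * (c * n) * n
          regroup″ = solve-∀
          regroup‴ : ∀ x y R n → x * (y * R) * n ≡ x * R * (y * n)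
          regroup‴ = solve-∀

        ratios-compare : (A + D) ^ p * X ^ q ≤ A ^ p * (X + Z) ^ q
        ratios-compare = ^-ratio-comparison p q A≡pD+R pDX≤qZR

        y₀^p*n^q<m^p*E^q : y₀ ^ p * n ^ q < m ^ p * E ^ q
        y₀^p*n^q<m^p*E^q = ratio-chain {y₀ ^ p} {m ^ p} {n ^ q} {E ^ q}
          {(A ^ m) ^ p} {((A + D) ^ m) ^ p} {(X ^ m) ^ q} {((X + Z) ^ m) ^ q}
          (subst₂ _<_ (^-distribʳ-* y₀ (A ^ m) p) (^-distribʳ-* m ((A + D) ^ m) p) (^-monoˡ-< p failure′))
          (subst₂ _≤_ (commute (A + D) X p q) (commute A (X + Z) p q) (^-monoˡ-≤ m ratios-compare))
          (subst₂ _≤_ (^-distribʳ-* n ((X + Z) ^ m) q) (^-distribʳ-* E (X ^ m) q) (^-monoˡ-≤ q slow))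
          where
          instance
            n^q*[X^m]^q≢0 : NonZero (n ^ q * (X ^ m) ^ q)
            n^q*[X^m]^q≢0 = m*n≢0 (n ^ q) ((X ^ m) ^ q) {{m^n≢0 n q}} {{m^n≢0 (X ^ m) q {{m^n≢0 X m}}}}
          failure′ : y₀ * A ^ m < m * (A + D) ^ m
          failure′ = subst (λ c → y₀ * A ^ m < m * c ^ m) n∸s≡A+D (failure m+D≤n)
          commute : ∀ x y i j → (x ^ i * y ^ j) ^ m ≡ (x ^ m) ^ i * (y ^ m) ^ j
          commute x y i j = trans (^-distribʳ-* (x ^ i) (y ^ j) m) (cong₂ _*_ (^-comm x i m) (^-comm y j m))

        n^p*n^q<[q+1]^p*m^p*E^q : n ^ p * n ^ q < suc q ^ p * (m ^ p * E ^ q)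
        n^p*n^q<[q+1]^p*m^p*E^q = begin-strict
          n ^ p * n ^ q                    <⟨ *-monoˡ-< (n ^ q) {{m^n≢0 n q}} (^-monoˡ-< p y₀-large) ⟩
          (y₀ * suc q) ^ p * n ^ q         ≡⟨ cong (_* n ^ q) (trans (^-distribʳ-* y₀ (suc q) p) (*-comm (y₀ ^ p) _)) ⟩
          suc q ^ p * y₀ ^ p * n ^ q       ≡⟨ *-assoc (suc q ^ p) _ _ ⟩
          suc q ^ p * (y₀ ^ p * n ^ q)     ≤⟨ *-monoʳ-≤ (suc q ^ p) (<⇒≤ y₀^p*n^q<m^p*E^q) ⟩
          suc q ^ p * (m ^ p * E ^ q)      ∎
          where open ≤-Reasoning

        m^p*E^[q+1]≤p^p*n^[q+1]*n^p : m ^ p * E ^ suc q ≤ p ^ p * (n ^ suc q * n ^ p)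
        m^p*E^[q+1]≤p^p*n^[q+1]*n^p = begin
          m ^ p * E ^ suc q                ≤⟨ *-monoˡ-≤ (E ^ suc q) (^-monoˡ-≤ p (<⇒≤ m<p[1+M])) ⟩
          (p * suc M) ^ p * E ^ suc q      ≡⟨ cong (_* E ^ suc q) (^-distribʳ-* p (suc M) p) ⟩
          p ^ p * suc M ^ p * E ^ suc q    ≡⟨ *-assoc (p ^ p) _ _ ⟩
          p ^ p * (suc M ^ p * E ^ suc q)  ≤⟨ *-monoʳ-≤ (p ^ p) few-blocks ⟩
          p ^ p * (n ^ suc q * n ^ p)      ∎
          where open ≤-Reasoning

        E<[[q+1]p]^p*n : E < (suc q * p) ^ p * n
        E<[[q+1]p]^p*n = *-cancelʳ-< (n ^ p * n ^ q) _ _ (begin-strict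
          E * (n ^ p * n ^ q)                              <⟨ *-monoʳ-< E n^p*n^q<[q+1]^p*m^p*E^q ⟩
          E * (suc q ^ p * (m ^ p * E ^ q))                ≡⟨ regroup E (suc q ^ p) (m ^ p) (E ^ q) ⟩
          suc q ^ p * (m ^ p * E ^ suc q)                  ≤⟨ *-monoʳ-≤ (suc q ^ p) m^p*E^[q+1]≤p^p*n^[q+1]*n^p ⟩
          suc q ^ p * (p ^ p * (n ^ suc q * n ^ p))        ≡⟨ regroup′ (suc q ^ p) (p ^ p) n (n ^ q) (n ^ p) ⟩
          suc q ^ p * p ^ p * n * (n ^ p * n ^ q)          ≡⟨ cong (λ w → w * n * (n ^ p * n ^ q)) (^-distribʳ-* (suc q) p p) ⟨
          (suc q * p) ^ p * n * (n ^ p * n ^ q)            ∎)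
          where
          open ≤-Reasoning
          regroup : ∀ E s mp Eq → E * (s * (mp * Eq)) ≡ s * (mp * (E * Eq))
          regroup = solve-∀
          regroup′ : ∀ s pp n nq np → s * (pp * (n * nq * np)) ≡ s * pp * n * (np * nq)
          regroup′ = solve-∀

        absurd : ⊥
        absurd = <⇒≱ E<[[q+1]p]^p*n (≤-trans (*-monoˡ-≤ n (^-monoˡ-≤ p [q+1]p≤16ap)) E-large)

      growth : E * X ^ m < n * (X + Z) ^ m
      growth = ≰⇒> absurd

module RationalBounds where

  open import Data.Nat as ℕ using (ℕ; zero; suc)
  import Data.Nat.Properties as ℕ
  import Data.Integer as ℤ
  import Data.Integer.Properties as ℤ
  open import Data.Rational
  open import Data.Rational.Properties
  import Data.Rational.Unnormalised as ℚᵘ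
  import Data.Rational.Unnormalised.Properties as ℚᵘ
  open import Data.Product using (∃; _,_; proj₁; proj₂)
  open import Data.Maybe using (Maybe; just; nothing)
  open import Algebra.Bundles using (CommutativeRing)
  open import Relation.Nullary using (yes; no)
  open import Relation.Binary.PropositionalEquality
  open import Tactic.RingSolver using (solve-∀)
  import Data.Nat.Tactic.RingSolver as NatSolver
  open import Tactic.RingSolver.Core.AlmostCommutativeRing using (AlmostCommutativeRing; fromCommutativeRing)
  open import Algebra.Properties.CommutativeSemiring.Exp (CommutativeRing.commutativeSemiring +-*-commutativeRing)
    using (_^_; ^-distrib-*)
  open import Defs using (ℕ→ℚ; expTerm; expSum; MulLogLt)

  ℚ-ring : AlmostCommutativeRing _ _
  ℚ-ring = fromCommutativeRing +-*-commutativeRing is-zero?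
    where
    is-zero? : ∀ x → Maybe (0ℚ ≡ x)
    is-zero? x with 0ℚ ≟ x
    ... | yes 0≡x = just 0≡x
    ... | no  _   = nothing

  ℕ→ℚ-suc : ∀ n → ℕ→ℚ (suc n) ≡ 1ℚ + ℕ→ℚ n
  ℕ→ℚ-suc n = toℚᵘ-injective (begin
    toℚᵘ (ℕ→ℚ (suc n))                       ≈⟨ toℚᵘ-fromℚᵘ (integral (suc n)) ⟩
    integral (suc n)                          ≈⟨ ℚᵘ.*≡* cross-multiplied ⟩
    integral 1 ℚᵘ.+ integral n                ≈⟨ ℚᵘ.+-cong (toℚᵘ-fromℚᵘ (integral 1)) (toℚᵘ-fromℚᵘ (integral n)) ⟨
    toℚᵘ 1ℚ ℚᵘ.+ toℚᵘ (ℕ→ℚ n)                ≈⟨ toℚᵘ-homo-+ 1ℚ (ℕ→ℚ n) ⟨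
    toℚᵘ (1ℚ + ℕ→ℚ n)                        ∎)
    where
    open ℚᵘ.≃-Reasoning
    integral : ℕ → ℚᵘ.ℚᵘ
    integral k = ℚᵘ.mkℚᵘ (ℤ.+ k) 0
    cross-multiplied : ℤ.+ suc n ℤ.* ℤ.+ 1 ≡ (ℤ.+ 1 ℤ.* ℤ.+ 1 ℤ.+ ℤ.+ n ℤ.* ℤ.+ 1) ℤ.* ℤ.+ 1
    cross-multiplied = trans (ℤ.*-identityʳ (ℤ.+ suc n))
      (sym (trans (ℤ.*-identityʳ _) (cong (λ w → (ℤ.+ 1) ℤ.+ w) (ℤ.*-identityʳ (ℤ.+ n)))))

  ℕ→ℚ-+ : ∀ m n → ℕ→ℚ (m ℕ.+ n) ≡ ℕ→ℚ m + ℕ→ℚ n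
  ℕ→ℚ-+ zero    n = sym (+-identityˡ (ℕ→ℚ n))
  ℕ→ℚ-+ (suc m) n = begin
    ℕ→ℚ (suc (m ℕ.+ n))    ≡⟨ ℕ→ℚ-suc (m ℕ.+ n) ⟩
    1ℚ + ℕ→ℚ (m ℕ.+ n)     ≡⟨ cong (1ℚ +_) (ℕ→ℚ-+ m n) ⟩
    1ℚ + (ℕ→ℚ m + ℕ→ℚ n)   ≡⟨ +-assoc 1ℚ (ℕ→ℚ m) (ℕ→ℚ n) ⟨
    1ℚ + ℕ→ℚ m + ℕ→ℚ n     ≡⟨ cong (_+ ℕ→ℚ n) (ℕ→ℚ-suc m) ⟨
    ℕ→ℚ (suc m) + ℕ→ℚ n    ∎
    where open ≡-Reasoning

  ℕ→ℚ-* : ∀ m n → ℕ→ℚ (m ℕ.* n) ≡ ℕ→ℚ m * ℕ→ℚ n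
  ℕ→ℚ-* zero    n = sym (*-zeroˡ (ℕ→ℚ n))
  ℕ→ℚ-* (suc m) n = begin
    ℕ→ℚ (n ℕ.+ m ℕ.* n)          ≡⟨ ℕ→ℚ-+ n (m ℕ.* n) ⟩
    ℕ→ℚ n + ℕ→ℚ (m ℕ.* n)        ≡⟨ cong (ℕ→ℚ n +_) (ℕ→ℚ-* m n) ⟩
    ℕ→ℚ n + ℕ→ℚ m * ℕ→ℚ n        ≡⟨ factor (ℕ→ℚ n) (ℕ→ℚ m) ⟩
    (1ℚ + ℕ→ℚ m) * ℕ→ℚ n         ≡⟨ cong (_* ℕ→ℚ n) (ℕ→ℚ-suc m) ⟨
    ℕ→ℚ (suc m) * ℕ→ℚ n          ∎
    where
    open ≡-Reasoning
    factor : ∀ x y → x + y * x ≡ (1ℚ + y) * x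
    factor = solve-∀ ℚ-ring

  ℕ→ℚ-^ : ∀ x k → ℕ→ℚ (x ℕ.^ k) ≡ ℕ→ℚ x ^ k
  ℕ→ℚ-^ x zero    = refl
  ℕ→ℚ-^ x (suc k) = trans (ℕ→ℚ-* x (x ℕ.^ k)) (cong (ℕ→ℚ x *_) (ℕ→ℚ-^ x k))

  ℕ→ℚ-nonNeg : ∀ n → 0ℚ ≤ ℕ→ℚ n
  ℕ→ℚ-nonNeg n = nonNegative⁻¹ (ℕ→ℚ n) {{normalize-nonNeg n 1}}

  0<1 : 0ℚ < 1ℚ
  0<1 = positive⁻¹ 1ℚ

  p≤p+q : ∀ p {q} → 0ℚ ≤ q → p ≤ p + q
  p≤p+q p {q} 0≤q = subst (_≤ p + q) (+-identityʳ p) (+-monoʳ-≤ p 0≤q)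

  ℕ→ℚ-mono-≤ : ∀ {m n} → m ℕ.≤ n → ℕ→ℚ m ≤ ℕ→ℚ n
  ℕ→ℚ-mono-≤ {m} {n} m≤n = begin
    ℕ→ℚ m                        ≤⟨ p≤p+q (ℕ→ℚ m) (ℕ→ℚ-nonNeg (n ℕ.∸ m)) ⟩
    ℕ→ℚ m + ℕ→ℚ (n ℕ.∸ m)        ≡⟨ ℕ→ℚ-+ m (n ℕ.∸ m) ⟨
    ℕ→ℚ (m ℕ.+ (n ℕ.∸ m))        ≡⟨ cong ℕ→ℚ (ℕ.m+[n∸m]≡n m≤n) ⟩
    ℕ→ℚ n                        ∎
    where open ≤-Reasoning

  ℕ→ℚ-mono-< : ∀ {m n} → m ℕ.< n → ℕ→ℚ m < ℕ→ℚ n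
  ℕ→ℚ-mono-< {m} {n} m<n = begin-strict
    ℕ→ℚ m          ≡⟨ +-identityˡ (ℕ→ℚ m) ⟨
    0ℚ + ℕ→ℚ m     <⟨ +-monoˡ-< (ℕ→ℚ m) 0<1 ⟩
    1ℚ + ℕ→ℚ m     ≡⟨ ℕ→ℚ-suc m ⟨
    ℕ→ℚ (suc m)    ≤⟨ ℕ→ℚ-mono-≤ m<n ⟩
    ℕ→ℚ n          ∎
    where open ≤-Reasoning

  ℕ→ℚ-cancel-≤ : ∀ {m n} → ℕ→ℚ m ≤ ℕ→ℚ n → m ℕ.≤ n
  ℕ→ℚ-cancel-≤ m≤n = ℕ.≮⇒≥ (λ n<m → <-irrefl refl (<-≤-trans (ℕ→ℚ-mono-< n<m) m≤n))

  archimedean : ∀ r → ∃ λ N → r ≤ ℕ→ℚ N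
  archimedean (mkℚ (ℤ.+ x) d _) =
    x , toℚᵘ-cancel-≤ (ℚᵘ.≤-respʳ-≃ (ℚᵘ.≃-sym (toℚᵘ-fromℚᵘ (ℚᵘ.mkℚᵘ (ℤ.+ x) 0))) (ℚᵘ.*≤* x≤x*[1+d]))
    where
    x≤x*[1+d] : ℤ.+ x ℤ.* ℤ.+ 1 ℤ.≤ ℤ.+ x ℤ.* ℤ.+ suc d
    x≤x*[1+d] rewrite ℤ.+◃n≡+n (x ℕ.* 1) | ℤ.+◃n≡+n (x ℕ.* suc d) = ℤ.+≤+ (ℕ.*-monoʳ-≤ x (ℕ.s≤s ℕ.z≤n))
  archimedean (mkℚ ℤ.-[1+ x ] d _) =
    0 , toℚᵘ-cancel-≤ (ℚᵘ.≤-respʳ-≃ (ℚᵘ.≃-sym (toℚᵘ-fromℚᵘ (ℚᵘ.mkℚᵘ (ℤ.+ 0) 0))) (ℚᵘ.*≤* ℤ.-≤+))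

  0≤p*q : ∀ {p q} → 0ℚ ≤ p → 0ℚ ≤ q → 0ℚ ≤ p * q
  0≤p*q {p} {q} 0≤p 0≤q = nonNegative⁻¹ (p * q) {{nonNeg*nonNeg⇒nonNeg p {{nonNegative 0≤p}} q {{nonNegative 0≤q}}}}

  1+k*1/[1+k]≡1 : ∀ k → ℕ→ℚ (suc k) * (ℤ.+ 1 / suc k) ≡ 1ℚ
  1+k*1/[1+k]≡1 k = toℚᵘ-injective (begin
    toℚᵘ (ℕ→ℚ (suc k) * (ℤ.+ 1 / suc k))                          ≈⟨ toℚᵘ-homo-* (ℕ→ℚ (suc k)) _ ⟩
    toℚᵘ (ℕ→ℚ (suc k)) ℚᵘ.* toℚᵘ (ℤ.+ 1 / suc k)
      ≈⟨ ℚᵘ.*-cong (toℚᵘ-fromℚᵘ (ℚᵘ.mkℚᵘ (ℤ.+ suc k) 0)) (toℚᵘ-fromℚᵘ (ℚᵘ.mkℚᵘ (ℤ.+ 1) k)) ⟩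
    ℚᵘ.mkℚᵘ (ℤ.+ suc k) 0 ℚᵘ.* ℚᵘ.mkℚᵘ (ℤ.+ 1) k                 ≈⟨ ℚᵘ.*≡* (cong ℤ.+[1+_] (cross-multiplied k)) ⟩
    toℚᵘ 1ℚ                                                         ∎)
    where
    open ℚᵘ.≃-Reasoning
    cross-multiplied : ∀ k → k ℕ.* 1 ℕ.* 1 ≡ k ℕ.+ 0 ℕ.* suc k ℕ.+ 0 ℕ.* suc (k ℕ.+ 0 ℕ.* suc k)
    cross-multiplied = NatSolver.solve-∀

  1/[1+k]-nonNeg : ∀ k → 0ℚ ≤ ℤ.+ 1 / suc k
  1/[1+k]-nonNeg k = nonNegative⁻¹ _ {{normalize-nonNeg 1 (suc k)}}

  expTerm-nonNeg : ∀ j {y} → 0ℚ ≤ y → 0ℚ ≤ expTerm y j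
  expTerm-nonNeg zero    0≤y = <⇒≤ 0<1
  expTerm-nonNeg (suc j) 0≤y = 0≤p*q (0≤p*q (expTerm-nonNeg j 0≤y) 0≤y) (1/[1+k]-nonNeg j)

  expTerm-recurrence : ∀ j y → expTerm y j * y ≡ ℕ→ℚ (suc j) * expTerm y (suc j)
  expTerm-recurrence j y = begin
    expTerm y j * y                                          ≡⟨ *-identityʳ _ ⟨
    expTerm y j * y * 1ℚ                                     ≡⟨ cong (expTerm y j * y *_) (1+k*1/[1+k]≡1 j) ⟨
    expTerm y j * y * (ℕ→ℚ (suc j) * (ℤ.+ 1 / suc j))        ≡⟨ swap (expTerm y j * y) (ℕ→ℚ (suc j)) (ℤ.+ 1 / suc j) ⟩
    ℕ→ℚ (suc j) * (expTerm y j * y * (ℤ.+ 1 / suc j))        ∎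
    where
    open ≡-Reasoning
    swap : ∀ a s i → a * (s * i) ≡ s * (a * i)
    swap = solve-∀ ℚ-ring

  -- The derivative of expTerm _ (j+1) is expTerm _ j, which is increasing on y ≥ 0.
  expTerm-increment : ∀ j {y r} → 0ℚ ≤ y → 0ℚ ≤ r →
                      expTerm y (suc j) + r * expTerm y j ≤ expTerm (y + r) (suc j)
  expTerm-increment zero {y} {r} _ _ = ≤-reflexive (expand y r)
    where
    expand : ∀ y r → 1ℚ * y * 1ℚ + r * 1ℚ ≡ 1ℚ * (y + r) * 1ℚ
    expand = solve-∀ ℚ-ring
  expTerm-increment (suc j) {y} {r} 0≤y 0≤r = begin
    A * y * i + r * A                   ≤⟨ p≤p+q (A * y * i + r * A) 0≤rrBi ⟩
    A * y * i + r * A + r * r * B * i   ≡⟨ expanded ⟨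
    (A + r * B) * (y + r) * i           ≤⟨ *-monoʳ-≤-nonNeg i {{nonNegative (1/[1+k]-nonNeg (suc j))}}
                                             (*-monoʳ-≤-nonNeg (y + r) {{nonNegative (+-mono-≤ 0≤y 0≤r)}} (expTerm-increment j 0≤y 0≤r)) ⟩
    expTerm (y + r) (suc j) * (y + r) * i ∎
    where
    open ≤-Reasoning
    A B i : ℚ
    A = expTerm y (suc j)
    B = expTerm y j
    i = ℤ.+ 1 / suc (suc j)
    0≤rrBi : 0ℚ ≤ r * r * B * i
    0≤rrBi = 0≤p*q (0≤p*q (0≤p*q 0≤r 0≤r) (expTerm-nonNeg j 0≤y)) (1/[1+k]-nonNeg (suc j))
    expanded : (A + r * B) * (y + r) * i ≡ A * y * i + r * A + r * r * B * i
    expanded = begin-equality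
      (A + r * B) * (y + r) * i                                        ≡⟨ expand A r B y i ⟩
      A * y * i + r * A * i + r * (B * y) * i + r * r * B * i          ≡⟨ cong (λ w → A * y * i + r * A * i + r * w * i + r * r * B * i) (expTerm-recurrence j y) ⟩
      A * y * i + r * A * i + r * (ℕ→ℚ (suc j) * A) * i + r * r * B * i ≡⟨ collect A y i r (ℕ→ℚ (suc j)) B ⟩
      A * y * i + r * A * ((1ℚ + ℕ→ℚ (suc j)) * i) + r * r * B * i     ≡⟨ cong (λ w → A * y * i + r * A * (w * i) + r * r * B * i) (ℕ→ℚ-suc (suc j)) ⟨
      A * y * i + r * A * (ℕ→ℚ (suc (suc j)) * i) + r * r * B * i      ≡⟨ cong (λ w → A * y * i + r * A * w + r * r * B * i) (1+k*1/[1+k]≡1 (suc j)) ⟩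
      A * y * i + r * A * 1ℚ + r * r * B * i                           ≡⟨ cong (λ w → A * y * i + w + r * r * B * i) (*-identityʳ (r * A)) ⟩
      A * y * i + r * A + r * r * B * i                                ∎
      where
      expand : ∀ A r B y i → (A + r * B) * (y + r) * i ≡ A * y * i + r * A * i + r * (B * y) * i + r * r * B * i
      expand = solve-∀ ℚ-ring
      collect : ∀ A y i r s B → A * y * i + r * A * i + r * (s * A) * i + r * r * B * i ≡ A * y * i + r * A * ((1ℚ + s) * i) + r * r * B * i
      collect = solve-∀ ℚ-ring

  expSum-increment : ∀ K {y r} → 0ℚ ≤ y → 0ℚ ≤ r →
                     expSum y K + r * expSum y K + expTerm y (suc K) ≤ expSum (y + r) (suc K)
  expSum-increment zero {y} {r} _ _ = ≤-reflexive (expand y r)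
    where
    expand : ∀ y r → 1ℚ + r * 1ℚ + 1ℚ * y * 1ℚ ≡ 1ℚ + 1ℚ * (y + r) * 1ℚ
    expand = solve-∀ ℚ-ring
  expSum-increment (suc K) {y} {r} 0≤y 0≤r = begin
    (S + t) + r * (S + t) + t′     ≡⟨ regroup S t r t′ ⟩
    (S + r * S + t) + (t′ + r * t) ≤⟨ +-mono-≤ (expSum-increment K 0≤y 0≤r) (expTerm-increment (suc K) 0≤y 0≤r) ⟩
    expSum (y + r) (suc K) + expTerm (y + r) (suc (suc K)) ∎
    where
    open ≤-Reasoning
    S t t′ : ℚ
    S  = expSum y K
    t  = expTerm y (suc K)
    t′ = expTerm y (suc (suc K))
    regroup : ∀ S t r t′ → (S + t) + r * (S + t) + t′ ≡ (S + r * S + t) + (t′ + r * t)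
    regroup = solve-∀ ℚ-ring

  1+r^m≤expSum : ∀ m {r} → 0ℚ ≤ r → (1ℚ + r) ^ m ≤ expSum (ℕ→ℚ m * r) m
  1+r^m≤expSum zero    _   = ≤-refl
  1+r^m≤expSum (suc m) {r} 0≤r = begin
    (1ℚ + r) * (1ℚ + r) ^ m                                   ≤⟨ *-monoˡ-≤-nonNeg (1ℚ + r) {{nonNegative 0≤1+r}} (1+r^m≤expSum m 0≤r) ⟩
    (1ℚ + r) * S                                              ≡⟨ distrib r S ⟩
    S + r * S                                                 ≤⟨ p≤p+q (S + r * S) (expTerm-nonNeg (suc m) 0≤mr) ⟩
    S + r * S + expTerm (ℕ→ℚ m * r) (suc m)                   ≤⟨ expSum-increment m 0≤mr 0≤r ⟩
    expSum (ℕ→ℚ m * r + r) (suc m)                            ≡⟨ cong (λ x → expSum x (suc m)) [m+1]r≡mr+r ⟨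
    expSum (ℕ→ℚ (suc m) * r) (suc m)                          ∎
    where
    open ≤-Reasoning
    S : ℚ
    S = expSum (ℕ→ℚ m * r) m
    0≤1+r : 0ℚ ≤ 1ℚ + r
    0≤1+r = +-mono-≤ (<⇒≤ 0<1) 0≤r
    0≤mr : 0ℚ ≤ ℕ→ℚ m * r
    0≤mr = 0≤p*q (ℕ→ℚ-nonNeg m) 0≤r
    distrib : ∀ r S → (1ℚ + r) * S ≡ S + r * S
    distrib = solve-∀ ℚ-ring
    factor : ∀ a r → (1ℚ + a) * r ≡ a * r + r
    factor = solve-∀ ℚ-ring
    [m+1]r≡mr+r : ℕ→ℚ (suc m) * r ≡ ℕ→ℚ m * r + r
    [m+1]r≡mr+r = trans (cong (_* r) (ℕ→ℚ-suc m)) (factor (ℕ→ℚ m) r)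

  ^-nonNeg : ∀ {x} k → 0ℚ ≤ x → 0ℚ ≤ x ^ k
  ^-nonNeg zero    _   = <⇒≤ 0<1
  ^-nonNeg (suc k) 0≤x = 0≤p*q 0≤x (^-nonNeg k 0≤x)

  ^-monoˡ-≤ : ∀ {x y} k → 0ℚ ≤ x → x ≤ y → x ^ k ≤ y ^ k
  ^-monoˡ-≤ zero    _   _   = ≤-refl
  ^-monoˡ-≤ {x} {y} (suc k) 0≤x x≤y = ≤-trans
    (*-monoʳ-≤-nonNeg (x ^ k) {{nonNegative (^-nonNeg k 0≤x)}} x≤y)
    (*-monoˡ-≤-nonNeg y {{nonNegative (≤-trans 0≤x x≤y)}} (^-monoˡ-≤ k 0≤x x≤y))

  below-[1+z]^m : ∀ {Δ z X Z c} m → 0ℚ ≤ X → 0ℚ ≤ Z → 0ℚ ≤ c → Z ≤ X * z →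
                  Δ * c * X ^ m < c * (X + Z) ^ m → Δ < (1ℚ + z) ^ m
  below-[1+z]^m {Δ} {z} {X} {Z} {c} m 0≤X 0≤Z 0≤c Z≤Xz growth =
    *-cancelʳ-<-nonNeg (c * X ^ m) {{nonNegative (0≤p*q 0≤c (^-nonNeg m 0≤X))}} (begin-strict
      Δ * (c * X ^ m)               ≡⟨ *-assoc Δ c (X ^ m) ⟨
      Δ * c * X ^ m                 <⟨ growth ⟩
      c * (X + Z) ^ m               ≤⟨ *-monoˡ-≤-nonNeg c {{nonNegative 0≤c}} (^-monoˡ-≤ m (+-mono-≤ 0≤X 0≤Z) X+Z≤X[1+z]) ⟩
      c * (X * (1ℚ + z)) ^ m        ≡⟨ cong (c *_) (^-distrib-* X (1ℚ + z) m) ⟩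
      c * (X ^ m * (1ℚ + z) ^ m)    ≡⟨ regroup c (X ^ m) ((1ℚ + z) ^ m) ⟩
      (1ℚ + z) ^ m * (c * X ^ m)    ∎)
    where
    open ≤-Reasoning
    regroup : ∀ x y w → x * (y * w) ≡ w * (x * y)
    regroup = solve-∀ ℚ-ring
    X+Z≤X[1+z] : X + Z ≤ X * (1ℚ + z)
    X+Z≤X[1+z] = subst (X + Z ≤_) (sym (trans (*-distribˡ-+ X 1ℚ z) (cong (_+ X * z) (*-identityʳ X)))) (+-monoʳ-≤ X Z≤Xz)

  ℕ→ℚ-growth : ∀ {Δ} {b n E m} → ℕ→ℚ E ≡ Δ * ℕ→ℚ n →
                E ℕ.* (b ℕ.* (n ℕ.* n)) ℕ.^ m ℕ.< n ℕ.* (b ℕ.* (n ℕ.* n) ℕ.+ suc b ℕ.* E) ℕ.^ m →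
                let X = ℕ→ℚ b * (ℕ→ℚ n * ℕ→ℚ n) ; Z = ℕ→ℚ (suc b) * (Δ * ℕ→ℚ n) in
                Δ * ℕ→ℚ n * X ^ m < ℕ→ℚ n * (X + Z) ^ m
  ℕ→ℚ-growth {Δ} {b} {n} {E} {m} E≡Δn growth = subst₂ _<_
    (trans (ℕ→ℚ-* E _) (cong₂ _*_ E≡Δn (trans (ℕ→ℚ-^ (b ℕ.* (n ℕ.* n)) m) (cong (_^ m) X≡))))
    (trans (ℕ→ℚ-* n _) (cong (ℕ→ℚ n *_) (trans (ℕ→ℚ-^ (b ℕ.* (n ℕ.* n) ℕ.+ suc b ℕ.* E) m)
      (cong (_^ m) (trans (ℕ→ℚ-+ (b ℕ.* (n ℕ.* n)) (suc b ℕ.* E)) (cong₂ _+_ X≡ Z≡))))))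
    (ℕ→ℚ-mono-< growth)
    where
    X≡ : ℕ→ℚ (b ℕ.* (n ℕ.* n)) ≡ ℕ→ℚ b * (ℕ→ℚ n * ℕ→ℚ n)
    X≡ = trans (ℕ→ℚ-* b (n ℕ.* n)) (cong (ℕ→ℚ b *_) (ℕ→ℚ-* n n))
    Z≡ : ℕ→ℚ (suc b ℕ.* E) ≡ ℕ→ℚ (suc b) * (Δ * ℕ→ℚ n)
    Z≡ = trans (ℕ→ℚ-* (suc b) E) (cong (ℕ→ℚ (suc b) *_) E≡Δn)

  slack⇒ratio≤ : ∀ {a b u Δ n} .{{_ : Positive (u * n)}} → 0ℚ ≤ Δ → 0ℚ ≤ n → a * u ≤ b →
                 a * (Δ * n) ≤ b * (n * n) * (Δ * (1/ (u * n)) {{pos⇒nonZero (u * n)}})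
  slack⇒ratio≤ {a} {b} {u} {Δ} {n} 0≤Δ 0≤n au≤b = *-cancelʳ-≤-pos (u * n) (begin
    a * (Δ * n) * (u * n)          ≡⟨ regroup a Δ n u ⟩
    a * u * (Δ * (n * n))          ≤⟨ *-monoʳ-≤-nonNeg (Δ * (n * n)) {{nonNegative (0≤p*q 0≤Δ (0≤p*q 0≤n 0≤n))}} au≤b ⟩
    b * (Δ * (n * n))              ≡⟨ regroup′ b Δ n ⟩
    b * (n * n) * Δ * 1ℚ           ≡⟨ cong (b * (n * n) * Δ *_) (*-inverseˡ (u * n)) ⟨
    b * (n * n) * Δ * (1/ (u * n) * (u * n)) ≡⟨ regroup″ (b * (n * n)) Δ (1/ (u * n)) (u * n) ⟩
    b * (n * n) * (Δ * 1/ (u * n)) * (u * n) ∎)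
    where
    open ≤-Reasoning
    instance
      un≢0 : NonZero (u * n)
      un≢0 = pos⇒nonZero (u * n)
    regroup : ∀ a Δ n u → a * (Δ * n) * (u * n) ≡ a * u * (Δ * (n * n))
    regroup = solve-∀ ℚ-ring
    regroup′ : ∀ b Δ n → b * (Δ * (n * n)) ≡ b * (n * n) * Δ * 1ℚ
    regroup′ = solve-∀ ℚ-ring
    regroup″ : ∀ X Δ i c → X * Δ * (i * c) ≡ X * (Δ * i) * c
    regroup″ = solve-∀ ℚ-ring

  growth⇒mulLogLt : ∀ {ε Δ : ℚ} {b n E m : ℕ} → 1ℚ ≤ Δ → ℕ→ℚ E ≡ Δ * ℕ→ℚ n →
                    ℕ→ℚ (suc b) * (1ℚ - ε) ≤ ℕ→ℚ b →
                    E ℕ.* (b ℕ.* (n ℕ.* n)) ℕ.^ m ℕ.< n ℕ.* (b ℕ.* (n ℕ.* n) ℕ.+ suc b ℕ.* E) ℕ.^ m →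
                    MulLogLt ((1ℚ - ε) * ℕ→ℚ n) Δ (ℕ→ℚ m * Δ)
  growth⇒mulLogLt {ε} {Δ} {b} {n} {E} {m} 1≤Δ E≡Δn slack growth with 0ℚ <? (1ℚ - ε) * ℕ→ℚ n
  ... | no  _   = 1≤Δ
  ... | yes c>0 = m , (begin-strict
        Δ                              <⟨ below-[1+z]^m m 0≤X 0≤Z (ℕ→ℚ-nonNeg n) Z≤Xz (ℕ→ℚ-growth {Δ} {b} {n} {E} {m} E≡Δn growth) ⟩
        (1ℚ + z) ^ m                   ≤⟨ 1+r^m≤expSum m 0≤z ⟩
        expSum (ℕ→ℚ m * z) m           ≡⟨ cong (λ x → expSum x m) (*-assoc (ℕ→ℚ m) Δ (1/ c)) ⟨
        expSum (ℕ→ℚ m * Δ * 1/ c) m    ∎)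
    where
    open ≤-Reasoning
    c : ℚ
    c = (1ℚ - ε) * ℕ→ℚ n
    instance
      c>0′ : Positive c
      c>0′ = positive c>0
      c≢0 : NonZero c
      c≢0 = pos⇒nonZero c
    z : ℚ
    z = Δ * 1/ c
    0≤Δ : 0ℚ ≤ Δ
    0≤Δ = ≤-trans (<⇒≤ 0<1) 1≤Δ
    0≤z : 0ℚ ≤ z
    0≤z = 0≤p*q 0≤Δ (<⇒≤ (positive⁻¹ (1/ c) {{1/pos⇒pos c}}))
    0≤X : 0ℚ ≤ ℕ→ℚ b * (ℕ→ℚ n * ℕ→ℚ n)
    0≤X = 0≤p*q (ℕ→ℚ-nonNeg b) (0≤p*q (ℕ→ℚ-nonNeg n) (ℕ→ℚ-nonNeg n))
    0≤Z : 0ℚ ≤ ℕ→ℚ (suc b) * (Δ * ℕ→ℚ n)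
    0≤Z = 0≤p*q (ℕ→ℚ-nonNeg (suc b)) (0≤p*q 0≤Δ (ℕ→ℚ-nonNeg n))
    Z≤Xz : ℕ→ℚ (suc b) * (Δ * ℕ→ℚ n) ≤ ℕ→ℚ b * (ℕ→ℚ n * ℕ→ℚ n) * z
    Z≤Xz = slack⇒ratio≤ {ℕ→ℚ (suc b)} {ℕ→ℚ b} {1ℚ - ε} {Δ} {ℕ→ℚ n} 0≤Δ (ℕ→ℚ-nonNeg n) slack

  slack-parameter : ∀ ε → 0ℚ < ε → ∃ λ N → ℕ→ℚ (2 ℕ.+ N) * (1ℚ - ε) ≤ ℕ→ℚ (suc N)
  slack-parameter ε ε>0 = N , discount {suc N} (begin
    1ℚ                 ≡⟨ *-inverseˡ ε ⟨
    1/ ε * ε           ≤⟨ *-monoʳ-≤-nonNeg ε {{nonNegative (<⇒≤ ε>0)}} 1/ε≤N ⟩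
    ℕ→ℚ N * ε          ≤⟨ *-monoʳ-≤-nonNeg ε {{nonNegative (<⇒≤ ε>0)}} (ℕ→ℚ-mono-≤ (ℕ.m≤n+m N 2)) ⟩
    ℕ→ℚ (2 ℕ.+ N) * ε  ∎)
    where
    open ≤-Reasoning
    instance
      ε≢0 : NonZero ε
      ε≢0 = pos⇒nonZero ε {{positive ε>0}}
    N : ℕ
    N = proj₁ (archimedean (1/ ε))
    1/ε≤N : 1/ ε ≤ ℕ→ℚ N
    1/ε≤N = proj₂ (archimedean (1/ ε))
    discount : ∀ {b} → 1ℚ ≤ ℕ→ℚ (suc b) * ε → ℕ→ℚ (suc b) * (1ℚ - ε) ≤ ℕ→ℚ b
    discount {b} 1≤aε = begin
      ℕ→ℚ (suc b) * (1ℚ - ε)                                ≤⟨ p≤p+q _ 0≤aε-1 ⟩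
      ℕ→ℚ (suc b) * (1ℚ - ε) + (ℕ→ℚ (suc b) * ε - 1ℚ)       ≡⟨ cong (λ a → a * (1ℚ - ε) + (a * ε - 1ℚ)) (ℕ→ℚ-suc b) ⟩
      (1ℚ + ℕ→ℚ b) * (1ℚ - ε) + ((1ℚ + ℕ→ℚ b) * ε - 1ℚ)     ≡⟨ cancel (ℕ→ℚ b) ε ⟩
      ℕ→ℚ b                                                 ∎
      where
      0≤aε-1 : 0ℚ ≤ ℕ→ℚ (suc b) * ε - 1ℚ
      0≤aε-1 = subst (_≤ ℕ→ℚ (suc b) * ε - 1ℚ) (+-inverseʳ 1ℚ) (+-monoˡ-≤ (- 1ℚ) 1≤aε)
      cancel : ∀ b ε → (1ℚ + b) * (1ℚ - ε) + ((1ℚ + b) * ε - 1ℚ) ≡ b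
      cancel = solve-∀ ℚ-ring

  ℕ→ℚ-scaled-≤ : ∀ {k n E Δ} → ℕ→ℚ E ≡ Δ * ℕ→ℚ n → ℕ→ℚ k ≤ Δ → k ℕ.* n ℕ.≤ E
  ℕ→ℚ-scaled-≤ {k} {n} E≡Δn k≤Δ = ℕ→ℚ-cancel-≤
    (subst₂ _≤_ (sym (ℕ→ℚ-* k n)) (sym E≡Δn) (*-monoʳ-≤-nonNeg (ℕ→ℚ n) {{nonNegative (ℕ→ℚ-nonNeg n)}} k≤Δ))

  ℕ→ℚ-scaled-≥ : ∀ {k n E Δ} → ℕ→ℚ E ≡ Δ * ℕ→ℚ n → Δ ≤ ℕ→ℚ k → E ℕ.≤ k ℕ.* n
  ℕ→ℚ-scaled-≥ {k} {n} E≡Δn Δ≤k = ℕ→ℚ-cancel-≤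
    (subst₂ _≤_ (sym E≡Δn) (sym (ℕ→ℚ-* k n)) (*-monoʳ-≤-nonNeg (ℕ→ℚ n) {{nonNegative (ℕ→ℚ-nonNeg n)}} Δ≤k))

module BiHoleGrowth where

  open import Defs using (BipGraph; edgeCount; HasBiHole)
  open import Data.Product using (Σ; _×_; _,_)
  open import Data.Nat
  open import Data.Nat.Properties
  open import Data.Nat.DivMod using (_/_; m/n*n≤m)
  open import Data.Nat.Tactic.RingSolver using (solve-∀)
  open import Relation.Binary.PropositionalEquality using (_≡_)
  open PowerInequalities using (m<[1+m/n]*n)
  open Greedy using (module BiHoleGreedy)
  open GrowthBound using (module Constants; module Growth)

  many-low-degree : ∀ {n E y D q} → n * suc D ≤ E + y * suc D → E * suc q < suc D * (q * n) → n < y * suc q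
  many-low-degree {n} {E} {y} {D} {q} markov D-tight = *-cancelˡ-< (suc D) n (y * suc q)
    (+-cancelˡ-< (suc D * (q * n)) _ _ (begin-strict
      suc D * (q * n) + suc D * n    ≡⟨ expand n D q ⟩
      n * suc D * suc q              ≤⟨ *-monoˡ-≤ (suc q) markov ⟩
      (E + y * suc D) * suc q        ≡⟨ expand′ E y D q ⟩
      E * suc q + suc D * (y * suc q) <⟨ +-monoˡ-< _ D-tight ⟩
      suc D * (q * n) + suc D * (y * suc q) ∎))
    where
    open ≤-Reasoning
    expand : ∀ n D q → suc D * (q * n) + suc D * n ≡ n * suc D * suc q
    expand = solve-∀
    expand′ : ∀ E y D q → (E + y * suc D) * suc q ≡ E * suc q + suc D * (y * suc q)
    expand′ = solve-∀

  bihole-growth : ∀ b .{{_ : NonZero b}} {n Δ⁺} (G : BipGraph n) → let open Constants b in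
                  Δ₀ * n ≤ edgeCount G → edgeCount G ≤ Δ⁺ * n → N₀ Δ⁺ ≤ n →
                  Σ ℕ λ t → HasBiHole G t × edgeCount G * (b * (n * n)) ^ suc t < n * (b * (n * n) + a * edgeCount G) ^ suc t
  bihole-growth b {n} {Δ⁺} G E-large E≤Δ⁺n N₀≤n =
    let (s , hole , failure) = greedy-bihole in
    s , hole , Growth.growth b n E lowCount D s E-large E-sparse D-bound (many-low-degree {n} {E} {lowCount} {D} {q} markov D-tight) failure
    where
    open Constants b
    E : ℕ
    E = edgeCount G
    instance
      n≢0 : NonZero n
      n≢0 = >-nonZero (<-≤-trans (>-nonZero⁻¹ (N₀ Δ⁺)) N₀≤n)
      qn≢0 : NonZero (q * n)
      qn≢0 = m*n≢0 q n
    E-sparse : 32 * a * suc p * E ≤ n * n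
    E-sparse = begin
      32 * a * suc p * E              ≤⟨ *-monoʳ-≤ (32 * a * suc p) E≤Δ⁺n ⟩
      32 * a * suc p * (Δ⁺ * n)       ≤⟨ *-monoʳ-≤ (32 * a * suc p) (*-monoˡ-≤ n (n≤1+n Δ⁺)) ⟩
      32 * a * suc p * (suc Δ⁺ * n)   ≡⟨ *-assoc (32 * a * suc p) (suc Δ⁺) n ⟨
      N₀ Δ⁺ * n                       ≤⟨ *-monoˡ-≤ n N₀≤n ⟩
      n * n                           ∎
      where open ≤-Reasoning
    D : ℕ
    D = (E * suc q) / (q * n)
    D-bound : D * (q * n) ≤ E * suc q
    D-bound = m/n*n≤m (E * suc q) (q * n)
    D-tight : E * suc q < suc D * (q * n)
    D-tight = m<[1+m/n]*n (E * suc q) (q * n)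
    open BiHoleGreedy G D

open import Defs
open import Data.Nat using (ℕ; suc) renaming (_≥_ to _≥ℕ_)
open import Data.Rational using (ℚ; 0ℚ; 1ℚ; _-_; _*_; _<_; _≤_)
open import Data.Product using (Σ; _×_; _,_; proj₁; proj₂)
open import Relation.Binary.PropositionalEquality using (_≡_)

open import Data.Rational.Properties using (≤-trans)
open GrowthBound using (module Constants)
open RationalBounds using (ℕ→ℚ-mono-≤; ℕ→ℚ-scaled-≤; ℕ→ℚ-scaled-≥; archimedean; slack-parameter; growth⇒mulLogLt)
open BiHoleGrowth using (bihole-growth)

theorem1p1 : (ε : ℚ) → 0ℚ < ε →
    Σ ℚ λ Δ₀ → (Δ : ℚ) → Δ₀ ≤ Δ →
    Σ ℕ λ N₀ → (n : ℕ) → n ≥ℕ N₀ → (G : BipGraph n) →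
    ℕ→ℚ (edgeCount G) ≡ Δ * ℕ→ℚ n →
    Σ ℕ λ t → HasBiHole G t ×
      MulLogLt ((1ℚ - ε) * ℕ→ℚ n) Δ (ℕ→ℚ (suc t) * Δ)
theorem1p1 ε ε>0 = ℕ→ℚ Δ₀ , λ Δ Δ₀≤Δ → N₀ ⌈ Δ ⌉ , λ n n≥N₀ G E≡Δn →
  let (t , hole , growth) =
        bihole-growth b G (ℕ→ℚ-scaled-≤ {Δ₀} E≡Δn Δ₀≤Δ) (ℕ→ℚ-scaled-≥ {⌈ Δ ⌉} E≡Δn (Δ≤⌈Δ⌉ Δ)) n≥N₀
  in t , hole , growth⇒mulLogLt {ε} {Δ} {b} {n} {edgeCount G} {suc t} (≤-trans (ℕ→ℚ-mono-≤ Δ₀>0) Δ₀≤Δ) E≡Δn slack growth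
  where
  b : ℕ
  b = suc (proj₁ (slack-parameter ε ε>0))
  slack : ℕ→ℚ (suc b) * (1ℚ - ε) ≤ ℕ→ℚ b
  slack = proj₂ (slack-parameter ε ε>0)
  open Constants b
  ⌈_⌉ : ℚ → ℕ
  ⌈ Δ ⌉ = proj₁ (archimedean Δ)
  Δ≤⌈Δ⌉ : ∀ Δ → Δ ≤ ℕ→ℚ ⌈ Δ ⌉
  Δ≤⌈Δ⌉ Δ = proj₂ (archimedean Δ)
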